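{- Let $m\in\mathbb{Q}_{>0}$. The map $\psi_{\sqcup\!\sqcup,m}:\mathbb{Q}[\mu]\langle X^\mu\rangle^0[T]\to\mathbb{Q}[\mu]\langle X^\mu\rangle^1$, $\sum_iw_iT^i\mapsto\sum_iw_i\sqcup\!\sqcup(y^\mu_m)^{\sqcup\!\sqcup i}$ (where $(y^\mu_m)^{\sqcup\!\sqcup i}$ is the $i$-fold shuffle power, and the polynomial ring is taken over the commutative algebra $(\mathbb{Q}[\mu]\langle X^\mu\rangle^0,\sqcup\!\sqcup)$), is an isomorphism of $(\mathbb{Q}[\mu]\langle X^\mu\rangle^0,\sqcup\!\sqcup)$-algebras onto $(\mathbb{Q}[\mu]\langle X^\mu\rangle^1,\sqcup\!\sqcup)$.
   Context: Fix $\mu\in\mathbb{C}$, $\mathrm{Re}(\mu)>0$; $\mathbb{Q}[\mu]\subset\mathbb{C}$ the ring generated by $\mu$. $X^\mu=\{x\}\cup\{y^\mu_l:l\in\mathbb{Q}\}$; $\mathbb{Q}[\mu]\langle X^\mu\rangle$ is the free $\mathbb{Q}[\mu]$-module on words over $X^\mu$ (empty word $1$). The shuffle product $\sqcup\!\sqcup$ is $\mathbb{Q}[\mu]$-bilinear with $1\sqcup\!\sqcup w=w\sqcup\!\sqcup1=w$ and $w_1u\sqcup\!\sqcup w_2v=(w_1\sqcup\!\sqcup w_2v)u+(w_1u\sqcup\!\sqcup w_2)v$ for letters $u,v$ and words $w_1,w_2$; it is commutative and associative. A bi-index $(\mathbf{k};\mathbf{m})\in\mathbb{N}^r\times\mathbb{Q}^r$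 is positive if all $m_i>0$ and admissible if moreover $k_r>1$; put $(y,x)^\mu_{\mathbf{k};\mathbf{m}}=y^\mu_{m_1}x^{k_1-1}y^\mu_{m_2-m_1}x^{k_2-1}\cdots y^\mu_{m_r-m_{r-1}}x^{k_r-1}$. $\mathbb{Q}[\mu]\langle X^\mu\rangle^1$ is the span of all words $y^\mu_{l_1}x^{t_1}\cdots y^\mu_{l_r}x^{t_r}$ ($r\ge0,t_i\ge0$) with $l_1+\dots+l_i>0$ for all $i$. $\mathbb{Q}[\mu]\langle X^\mu\rangle^0$ is the span of $1$, all $(y,x)^\mu_{\mathbf{k};\mathbf{m}}$ with $(\mathbf{k};\mathbf{m})$ admissible, and all $(y,x)^\mu_{\mathbf{k};\mathbf{m}}-(y,x)^\mu_{\mathbf{k};\tilde{\mathbf{m}}}$ where $\mathbf{k}=(k_1,\dots,k_{r-1},1)$, $\mathbf{m}=(m_1,\dots,m_r)$, $\tilde{\mathbf{m}}=(m_1,\dots,m_{r-1},\tilde m_r)$, all entries in $\mathbb{Q}_{>0}$, $\tilde m_r\ne m_r$; it is a $\sqcup\!\sqcup$-subalgebra of $\mathbb{Q}[\mu]\langle X^\mu\rangle^1$. -}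

module Defs where

open import Level using (0ℓ)
open import Algebra.Bundles using (CommutativeRing)
open import Data.Nat as ℕ using (ℕ; zero; suc; _∸_)
open import Data.Rational as ℚ using (ℚ; 0ℚ; 1ℚ)
open import Data.List using (List; []; _∷_; _++_; map; concatMap; replicate; reverse; foldr)
open import Data.List.Properties using (≡-dec)
open import Data.List.Relation.Unary.All using (All)
open import Data.Product using (Σ; _×_; _,_; ∃; proj₁; proj₂)
open import Data.Sum using (_⊎_)
open import Relation.Binary.PropositionalEquality using (_≡_; _≢_; refl; cong)
open import Relation.Nullary using (Dec; yes; no; ¬_)
open import Relation.Nullary.Decidable using (map′)

data Letter : Set where
  x : Letter
  y : ℚ → Letter

Word : Set
Word = List Letter

y-inj : ∀ {a b} → y a ≡ y b → a ≡ b
y-inj refl = refl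

_≟L_ : (u v : Letter) → Dec (u ≡ v)
x ≟L x = yes refl
x ≟L y _ = no λ ()
y _ ≟L x = no λ ()
y a ≟L y b = map′ (cong y) y-inj (a ℚ.≟ b)

_≟W_ : (u v : Word) → Dec (u ≡ v)
_≟W_ = ≡-dec _≟L_

-- Shuffle of two words, as a list (multiset) of words.
-- shF is the recursion on first letters; the paper's recursion is on
-- LAST letters, which we obtain literally by reversing:
--   w₁u ⧢ w₂v = (w₁ ⧢ w₂v)u + (w₁u ⧢ w₂)v.

shF : Word → Word → List Word
shF [] vs = vs ∷ []
shF (u ∷ us) [] = (u ∷ us) ∷ []
shF (u ∷ us) (v ∷ vs) = map (u ∷_) (shF us (v ∷ vs)) ++ map (v ∷_) (shF (u ∷ us) vs)

shW : Word → Word → List Word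
shW w₁ w₂ = map reverse (shF (reverse w₁) (reverse w₂))

BiIdx : Set
BiIdx = List (ℕ × ℚ)

-- (y,x)_{k;m} = y_{m₁} x^{k₁-1} y_{m₂-m₁} x^{k₂-1} ⋯
yxFrom : ℚ → BiIdx → Word
yxFrom prev [] = []
yxFrom prev ((k , m) ∷ r) = y (m ℚ.- prev) ∷ (replicate (k ∸ 1) x ++ yxFrom m r)

yx : BiIdx → Word
yx = yxFrom 0ℚ

PosEntry : ℕ × ℚ → Set
PosEntry (k , m) = (1 ℕ.≤ k) × (0ℚ ℚ.< m)

Positive : BiIdx → Set
Positive = All PosEntry

Admissible : BiIdx → Set
Admissible ks = Positive ks ×
  Σ BiIdx λ ps → Σ ℕ λ k → Σ ℚ λ m → (ks ≡ ps ++ ((k , m) ∷ [])) × (1 ℕ.< k)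

-- words y_{l₁}x^{t₁}⋯y_{l_r}x^{t_r} with l₁+⋯+l_i > 0 for all i
-- (GoodFrom s w: prefix sums, started at s, are positive at each y-letter)
GoodFrom : ℚ → Word → Set
GoodFrom s [] = Data.Unit.⊤ where import Data.Unit
GoodFrom s (x ∷ w) = GoodFrom s w
GoodFrom s (y l ∷ w) = (0ℚ ℚ.< s ℚ.+ l) × GoodFrom (s ℚ.+ l) w

StartsWithY : Word → Set
StartsWithY [] = Data.Unit.⊤ where import Data.Unit
StartsWithY (x ∷ _) = Data.Empty.⊥ where import Data.Empty
StartsWithY (y _ ∷ _) = Data.Unit.⊤ where import Data.Unit

Word1 : Word → Set
Word1 w = StartsWithY w × GoodFrom 0ℚ w

-- The coefficient ring Q[μ]: a commutative ring R with a ring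
-- homomorphism ι : ℚ → R, which is an integral domain (1 ≠ 0) and is
-- generated as a ℚ-algebra by the element μ.  (These are exactly the
-- rings ℚ[μ] ⊂ ℂ, up to isomorphism.)

record IsQmu (R : CommutativeRing 0ℓ 0ℓ) (ι : ℚ → CommutativeRing.Carrier R)
             (μ : CommutativeRing.Carrier R) : Set where
  open CommutativeRing R
  evalμ : List ℚ → Carrier
  evalμ = foldr (λ c acc → ι c + μ * acc) 0#
  field
    ι-cong  : ∀ a b → a ≡ b → ι a ≈ ι b
    ι-1     : ι 1ℚ ≈ 1#
    ι-+     : ∀ a b → ι (a ℚ.+ b) ≈ ι a + ι b
    ι-*     : ∀ a b → ι (a ℚ.* b) ≈ ι a * ι b
    nontriv : ¬ (1# ≈ 0#)
    domain  : ∀ a b → a * b ≈ 0# → (a ≈ 0#) ⊎ (b ≈ 0#)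
    gen     : ∀ r → Σ (List ℚ) λ cs → r ≈ evalμ cs

module Shuffle (R : CommutativeRing 0ℓ 0ℓ) where
  open CommutativeRing R

  LC : Set
  LC = List (Carrier × Word)

  coeff : Word → LC → Carrier
  coeff w [] = 0#
  coeff w ((r , v) ∷ p) with v ≟W w
  ... | yes _ = r + coeff w p
  ... | no  _ = coeff w p

  _≋_ : LC → LC → Set
  p ≋ q = ∀ w → coeff w p ≈ coeff w q

  word : Word → LC
  word w = (1# , w) ∷ []

  zeroLC : LC
  zeroLC = []

  oneLC : LC
  oneLC = word []

  _⊕_ : LC → LC → LC
  _⊕_ = _++_

  scale : Carrier → LC → LC
  scale c = map (λ e → (c * proj₁ e , proj₂ e))

  _⊖_ : LC → LC → LC
  p ⊖ q = p ⊕ scale (- 1#) q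

  _⧢_ : LC → LC → LC
  p ⧢ q = concatMap (λ a → concatMap (λ b →
            map (λ w → (proj₁ a * proj₁ b , w)) (shW (proj₂ a) (proj₂ b))) q) p

  shPow : LC → ℕ → LC
  shPow p zero = oneLC
  shPow p (suc n) = shPow p n ⧢ p

  In1 : LC → Set
  In1 p = Σ LC λ L → All (λ e → Word1 (proj₂ e)) L × (p ≋ L)

  data Gen0 : LC → Set where
    gen-one : Gen0 oneLC
    gen-adm : (ks : BiIdx) → Admissible ks → Gen0 (word (yx ks))
    gen-dif : (ps : BiIdx) (a b : ℚ) → Positive ps →
              0ℚ ℚ.< a → 0ℚ ℚ.< b → a ≢ b →
              Gen0 (word (yx (ps ++ ((1 , a) ∷ []))) ⊖ word (yx (ps ++ ((1 , b) ∷ []))))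

  In0 : LC → Set
  In0 p = Σ (List (Carrier × LC)) λ L → All (λ e → Gen0 (proj₂ e)) L ×
            (p ≋ concatMap (λ e → scale (proj₁ e) (proj₂ e)) L)

  -- Polynomials in T with coefficients in R⟨X⟩ (index i ↦ coefficient
  -- of T^i); the ring R⟨X⟩⁰[T] consists of those with all coefficients
  -- in R⟨X⟩⁰.

  Poly : Set
  Poly = List LC

  pcoeff : ℕ → Poly → LC
  pcoeff i [] = zeroLC
  pcoeff zero (a ∷ P) = a
  pcoeff (suc i) (a ∷ P) = pcoeff i P

  _≋P_ : Poly → Poly → Set
  P ≋P Q = ∀ i → pcoeff i P ≋ pcoeff i Q

  Poly0 : Poly → Set
  Poly0 = All In0

  padd : Poly → Poly → Poly
  padd [] Q = Q
  padd (a ∷ P) [] = a ∷ P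
  padd (a ∷ P) (b ∷ Q) = (a ⊕ b) ∷ padd P Q

  pmul : Poly → Poly → Poly
  pmul [] Q = []
  pmul (a ∷ P) Q = padd (map (a ⧢_) Q) (zeroLC ∷ pmul P Q)

  pconst : LC → Poly
  pconst a = a ∷ []

  ψFrom : ℚ → ℕ → Poly → LC
  ψFrom m i [] = zeroLC
  ψFrom m i (w ∷ P) = (w ⧢ shPow (word (y m ∷ [])) i) ⊕ ψFrom m (suc i) P

  ψ : ℚ → Poly → LC
  ψ m = ψFrom m 0

-- The map ∂ deleting a final letter y_l (w y_l ↦ w, words ending in x ↦ 0)
-- is a derivation of the shuffle algebra, because the last letter of a
-- shuffle comes from one of the two factors.  ∂ annihilates R⟨X⟩⁰
-- (admissible words end in x, and the two words of a difference generator
-- lose the same final letter) and ∂ y_m = 1, so ∂ ∘ ψ = ψ ∘ d/dT.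
-- Conversely ker ∂ ∩ R⟨X⟩¹ = R⟨X⟩⁰: a word u y_l differs from the
-- "canonical" word u y_{1-|u|} by a difference generator.  Hence, since
-- positive integers are invertible, ψ is injective by induction on the
-- degree, and surjective by induction on the word length: the words of ∂p
-- are shorter, a preimage of ∂p integrated in T hits p up to an element of
-- ker ∂ = R⟨X⟩⁰.
module Submission where

open import Defs
open import Level using (0ℓ)
open import Algebra.Bundles using (CommutativeRing; CommutativeMonoid)
open import Data.Rational as ℚ using (ℚ; 0ℚ; 1ℚ)
import Data.Rational.Properties as ℚP
open import Data.Product using (Σ; _×_; _,_; proj₁; proj₂)
open import Data.Unit using (tt)
open import Data.Nat as ℕ using (ℕ; zero; suc; z≤n; s≤s)
import Data.Nat.Properties as ℕP
open import Data.Empty using (⊥-elim)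
open import Data.List using (List; []; _∷_; _++_; map; concatMap; reverse; replicate; length; drop)
open import Data.List.Properties
  using (reverse-involutive; reverse-++; ++-assoc; ++-identityʳ; concatMap-++; length-++; length-drop)
open import Data.List.Reverse using ([]; _∶_∶ʳ_; reverseView)
open import Data.List.Relation.Unary.All as All using (All; []; _∷_)
import Data.List.Relation.Unary.All.Properties as AllP
import Data.List.Relation.Binary.Pointwise as Pointwise
open import Data.List.Relation.Ternary.Interleaving.Propositional
  using (Interleaving; []; consˡ; consʳ; left; right)
open import Data.List.Relation.Ternary.Interleaving.Properties using (reverse⁺)
open import Relation.Nullary using (¬_; yes; no)
open import Relation.Binary.PropositionalEquality as ≡
  using (_≡_; refl; cong; cong₂; subst; subst₂)

import Algebra.Properties.AbelianGroup ℚP.+-0-abelianGroup as ℚ-+-AbelianGroup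
import Algebra.Properties.Group ℚP.+-0-group as ℚ-+-Group
import Algebra.Properties.CommutativeSemigroup
  (CommutativeMonoid.commutativeSemigroup ℚP.+-0-commutativeMonoid) as ℚ-+-CommutativeSemigroup

m+[n-m]≡n : ∀ m n → m ℚ.+ (n ℚ.- m) ≡ n
m+[n-m]≡n m n = ≡.trans (ℚP.+-comm m (n ℚ.- m)) (ℚ-+-Group.//-rightDividesˡ m n)

[m+n]-m≡n : ∀ m n → (m ℚ.+ n) ℚ.- m ≡ n
[m+n]-m≡n = ℚ-+-AbelianGroup.xyx⁻¹≈y

-- Words of R⟨X⟩¹

shF-interleaving : ∀ a b → All (Interleaving a b) (shF a b)
shF-interleaving [] b = right (Pointwise.refl refl) ∷ []
shF-interleaving (u ∷ a) [] = left (Pointwise.refl refl) ∷ []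
shF-interleaving (u ∷ a) (v ∷ b) =
  AllP.++⁺ (AllP.map⁺ (All.map consˡ (shF-interleaving a (v ∷ b))))
           (AllP.map⁺ (All.map consʳ (shF-interleaving (u ∷ a) b)))

shW-interleaving : ∀ a b → All (Interleaving a b) (shW a b)
shW-interleaving a b = AllP.map⁺ (All.map unreverse (shF-interleaving (reverse a) (reverse b)))
  where
    unreverse : ∀ {w} → Interleaving (reverse a) (reverse b) w → Interleaving a b (reverse w)
    unreverse il = subst₂ (λ a′ b′ → Interleaving a′ b′ _)
                          (reverse-involutive a) (reverse-involutive b) (reverse⁺ il)

GoodFrom-interleaving : ∀ {a b w} s t → Interleaving a b w → 0ℚ ℚ.≤ s → 0ℚ ℚ.≤ t →
                        GoodFrom s a → GoodFrom t b → GoodFrom (s ℚ.+ t) w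
GoodFrom-interleaving s t [] _ _ _ _ = tt
GoodFrom-interleaving {x ∷ _} s t (consˡ il) 0≤s 0≤t ga gb =
  GoodFrom-interleaving s t il 0≤s 0≤t ga gb
GoodFrom-interleaving {y l ∷ _} {w = _ ∷ w} s t (consˡ il) 0≤s 0≤t (0<s+l , ga) gb =
  subst (λ r → (0ℚ ℚ.< r) × GoodFrom r w) (ℚ-+-CommutativeSemigroup.xy∙z≈xz∙y s l t)
    (ℚP.+-mono-<-≤ 0<s+l 0≤t ,
     GoodFrom-interleaving (s ℚ.+ l) t il (ℚP.<⇒≤ 0<s+l) 0≤t ga gb)
GoodFrom-interleaving {b = x ∷ _} s t (consʳ il) 0≤s 0≤t ga gb =
  GoodFrom-interleaving s t il 0≤s 0≤t ga gb
GoodFrom-interleaving {b = y l ∷ _} {_ ∷ w} s t (consʳ il) 0≤s 0≤t ga (0<t+l , gb) =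
  subst (λ r → (0ℚ ℚ.< r) × GoodFrom r w) (≡.sym (ℚP.+-assoc s t l))
    (ℚP.+-mono-≤-< 0≤s 0<t+l ,
     GoodFrom-interleaving s (t ℚ.+ l) il 0≤s (ℚP.<⇒≤ 0<t+l) ga gb)

StartsWithY-interleaving : ∀ {a b w} → Interleaving a b w →
                           StartsWithY a → StartsWithY b → StartsWithY w
StartsWithY-interleaving [] _ _ = tt
StartsWithY-interleaving {y _ ∷ _} (consˡ _) _ _ = tt
StartsWithY-interleaving {b = y _ ∷ _} (consʳ _) _ _ = tt

Word1-interleaving : ∀ {a b w} → Interleaving a b w → Word1 a → Word1 b → Word1 w
Word1-interleaving {w = w} il (sa , ga) (sb , gb) =
  StartsWithY-interleaving il sa sb ,
  subst (λ s → GoodFrom s w) (ℚP.+-identityʳ 0ℚ)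
        (GoodFrom-interleaving 0ℚ 0ℚ il ℚP.≤-refl ℚP.≤-refl ga gb)

Word1-shW : ∀ a b → Word1 a → Word1 b → All Word1 (shW a b)
Word1-shW a b wa wb = All.map (λ il → Word1-interleaving il wa wb) (shW-interleaving a b)

GoodFrom-x^n : ∀ s n w → GoodFrom s w → GoodFrom s (replicate n x ++ w)
GoodFrom-x^n s zero w g = g
GoodFrom-x^n s (suc n) w g = GoodFrom-x^n s n w g

GoodFrom-yxFrom : ∀ s ks → Positive ks → GoodFrom s (yxFrom s ks)
GoodFrom-yxFrom s [] [] = tt
GoodFrom-yxFrom s ((k , m) ∷ ks) ((_ , 0<m) ∷ pos) =
  subst (λ r → (0ℚ ℚ.< r) × GoodFrom r (replicate (k ℕ.∸ 1) x ++ yxFrom m ks))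
        (≡.sym (m+[n-m]≡n s m))
        (0<m , GoodFrom-x^n m (k ℕ.∸ 1) _ (GoodFrom-yxFrom m ks pos))

Word1-yx : ∀ ks → Positive ks → Word1 (yx ks)
Word1-yx [] _ = tt , tt
Word1-yx (e ∷ ks) pos = tt , GoodFrom-yxFrom 0ℚ (e ∷ ks) pos

-- m_r, or the start value s when r = 0
finalM : ℚ → BiIdx → ℚ
finalM s [] = s
finalM s ((_ , m) ∷ ks) = finalM m ks

yxFrom-snoc : ∀ s ps k m → yxFrom s (ps ++ (k , m) ∷ []) ≡
              yxFrom s ps ++ y (m ℚ.- finalM s ps) ∷ replicate (k ℕ.∸ 1) x
yxFrom-snoc s [] k m = cong (λ w → y (m ℚ.- s) ∷ w) (++-identityʳ _)
yxFrom-snoc s ((k′ , m′) ∷ ps) k m = cong (y (m′ ℚ.- s) ∷_)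
  (≡.trans (cong (replicate (k′ ℕ.∸ 1) x ++_) (yxFrom-snoc m′ ps k m))
         (≡.sym (++-assoc (replicate (k′ ℕ.∸ 1) x) _ _)))

ySum : ℚ → Word → ℚ
ySum s [] = s
ySum s (x ∷ w) = ySum s w
ySum s (y l ∷ w) = ySum (s ℚ.+ l) w

-- A word x^t (y,x)_{k;m} read off: the leading exponent t and the bi-index,
-- the m_i being the partial sums of the y-indices.
toBiIdx : ℚ → Word → ℕ × BiIdx
toBiIdx s [] = 0 , []
toBiIdx s (x ∷ w) = suc (proj₁ (toBiIdx s w)) , proj₂ (toBiIdx s w)
toBiIdx s (y l ∷ w) =
  0 , (suc (proj₁ (toBiIdx (s ℚ.+ l) w)) , s ℚ.+ l) ∷ proj₂ (toBiIdx (s ℚ.+ l) w)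

toBiIdx-correct : ∀ s w → replicate (proj₁ (toBiIdx s w)) x ++ yxFrom s (proj₂ (toBiIdx s w)) ≡ w
toBiIdx-correct s [] = refl
toBiIdx-correct s (x ∷ w) = cong (x ∷_) (toBiIdx-correct s w)
toBiIdx-correct s (y l ∷ w) = cong₂ (λ l′ w′ → y l′ ∷ w′) ([m+n]-m≡n s l) (toBiIdx-correct (s ℚ.+ l) w)

toBiIdx-positive : ∀ s w → GoodFrom s w → Positive (proj₂ (toBiIdx s w))
toBiIdx-positive s [] _ = []
toBiIdx-positive s (x ∷ w) g = toBiIdx-positive s w g
toBiIdx-positive s (y l ∷ w) (0<s+l , g) = (s≤s z≤n , 0<s+l) ∷ toBiIdx-positive (s ℚ.+ l) w g

toBiIdx-finalM : ∀ s w → finalM s (proj₂ (toBiIdx s w)) ≡ ySum s w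
toBiIdx-finalM s [] = refl
toBiIdx-finalM s (x ∷ w) = toBiIdx-finalM s w
toBiIdx-finalM s (y l ∷ w) = toBiIdx-finalM (s ℚ.+ l) w

toBiIdx-StartsWithY : ∀ s w → StartsWithY w → proj₁ (toBiIdx s w) ≡ 0
toBiIdx-StartsWithY s [] _ = refl
toBiIdx-StartsWithY s (y l ∷ w) _ = refl

Word1⇒positive-yx : ∀ u → Word1 u →
  Σ BiIdx λ ps → Positive ps × (yx ps ≡ u) × (finalM 0ℚ ps ≡ ySum 0ℚ u)
Word1⇒positive-yx u (st , g) =
  proj₂ (toBiIdx 0ℚ u) , toBiIdx-positive 0ℚ u g ,
  subst (λ t → replicate t x ++ yx (proj₂ (toBiIdx 0ℚ u)) ≡ u)
        (toBiIdx-StartsWithY 0ℚ u st) (toBiIdx-correct 0ℚ u) ,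
  toBiIdx-finalM 0ℚ u

incrLastK : BiIdx → BiIdx
incrLastK [] = []
incrLastK ((k , m) ∷ []) = (suc k , m) ∷ []
incrLastK (e ∷ e′ ∷ ks) = e ∷ incrLastK (e′ ∷ ks)

appendX : ℕ × BiIdx → ℕ × BiIdx
appendX (t , []) = suc t , []
appendX (t , e ∷ ks) = t , incrLastK (e ∷ ks)

toBiIdx-appendX : ∀ s w → toBiIdx s (w ++ x ∷ []) ≡ appendX (toBiIdx s w)
toBiIdx-appendX s [] = refl
toBiIdx-appendX s (x ∷ w) rewrite toBiIdx-appendX s w with toBiIdx s w
... | (t , []) = refl
... | (t , e ∷ ks) = refl
toBiIdx-appendX s (y l ∷ w) rewrite toBiIdx-appendX (s ℚ.+ l) w with toBiIdx (s ℚ.+ l) w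
... | (t , []) = refl
... | (t , e ∷ ks) = refl

incrLastK-lastK>1 : ∀ e ks → Positive (e ∷ ks) →
  Σ BiIdx λ ps → Σ ℕ λ k → Σ ℚ λ m → (incrLastK (e ∷ ks) ≡ ps ++ (k , m) ∷ []) × (1 ℕ.< k)
incrLastK-lastK>1 (k , m) [] ((1≤k , _) ∷ []) = [] , suc k , m , refl , s≤s 1≤k
incrLastK-lastK>1 e (e′ ∷ ks) (_ ∷ pos) with incrLastK-lastK>1 e′ ks pos
... | ps , k , m , eq , 1<k = e ∷ ps , k , m , cong (e ∷_) eq , 1<k

GoodFrom-prefix : ∀ s u v → GoodFrom s (u ++ v) → GoodFrom s u
GoodFrom-prefix s [] v _ = tt
GoodFrom-prefix s (x ∷ u) v g = GoodFrom-prefix s u v g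
GoodFrom-prefix s (y l ∷ u) v (p , g) = p , GoodFrom-prefix (s ℚ.+ l) u v g

Word1-prefix : ∀ u v → Word1 (u ++ v) → Word1 u
Word1-prefix [] v _ = tt , tt
Word1-prefix (y l ∷ u) v (_ , g) = tt , GoodFrom-prefix 0ℚ (y l ∷ u) v g

Word1-∷ʳx⇒admissible-yx : ∀ u → Word1 (u ++ x ∷ []) → Σ BiIdx λ ks → Admissible ks × (yx ks ≡ u ++ x ∷ [])
Word1-∷ʳx⇒admissible-yx (y l ∷ u) (_ , g) =
  proj₂ (toBiIdx 0ℚ w) ,
  (toBiIdx-positive 0ℚ w g ,
   subst (λ t → Σ BiIdx λ ps → Σ ℕ λ k → Σ ℚ λ m → (proj₂ t ≡ ps ++ (k , m) ∷ []) × (1 ℕ.< k))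
         (≡.sym (toBiIdx-appendX 0ℚ (y l ∷ u)))
         (incrLastK-lastK>1 _ _ (toBiIdx-positive 0ℚ (y l ∷ u) (GoodFrom-prefix 0ℚ (y l ∷ u) (x ∷ []) g)))) ,
  toBiIdx-correct 0ℚ w
  where w = y l ∷ u ++ x ∷ []

GoodFrom-last : ∀ s u l → GoodFrom s (u ++ y l ∷ []) → 0ℚ ℚ.< ySum s u ℚ.+ l
GoodFrom-last s [] l (p , _) = p
GoodFrom-last s (x ∷ u) l g = GoodFrom-last s u l g
GoodFrom-last s (y l′ ∷ u) l (_ , g) = GoodFrom-last (s ℚ.+ l′) u l g

module ShuffleAlgebra (R : CommutativeRing 0ℓ 0ℓ) where
  open CommutativeRing R renaming (refl to ≈-refl)
  open Shuffle R
  open import Relation.Binary.Reasoning.Setoid setoid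
  open import Algebra.Properties.CommutativeSemigroup +-commutativeSemigroup
    using (interchange)
  open import Algebra.Properties.Ring ring using (-1*x≈-x)
  open import Algebra.Definitions.RawMonoid +-rawMonoid using () renaming (_×_ to _·_)
  open import Algebra.Properties.Group +-group
    using (x∙y⁻¹≈ε⇒x≈y; x≈y⇒x∙y⁻¹≈ε; //-rightDividesˡ; //-rightDividesʳ)

  sumOver : (Word → Carrier) → List Word → Carrier
  sumOver f [] = 0#
  sumOver f (w ∷ ws) = f w + sumOver f ws

  sumOver-++ : ∀ f ws vs → sumOver f (ws ++ vs) ≈ sumOver f ws + sumOver f vs
  sumOver-++ f [] vs = sym (+-identityˡ _)
  sumOver-++ f (w ∷ ws) vs = trans (+-congˡ (sumOver-++ f ws vs)) (sym (+-assoc _ _ _))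

  sumOver-map : ∀ f (h : Word → Word) ws → sumOver f (map h ws) ≡ sumOver (λ w → f (h w)) ws
  sumOver-map f h [] = refl
  sumOver-map f h (w ∷ ws) = cong (f (h w) +_) (sumOver-map f h ws)

  sumOver-cong : ∀ {f g} → (∀ w → f w ≈ g w) → ∀ ws → sumOver f ws ≈ sumOver g ws
  sumOver-cong f≈g [] = ≈-refl
  sumOver-cong f≈g (w ∷ ws) = +-cong (f≈g w) (sumOver-cong f≈g ws)

  sumOver-+ : ∀ f g ws → sumOver (λ w → f w + g w) ws ≈ sumOver f ws + sumOver g ws
  sumOver-+ f g [] = sym (+-identityˡ _)
  sumOver-+ f g (w ∷ ws) = trans (+-congˡ (sumOver-+ f g ws)) (interchange _ _ _ _)

  sumOver-0 : ∀ ws → sumOver (λ _ → 0#) ws ≈ 0#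
  sumOver-0 [] = ≈-refl
  sumOver-0 (w ∷ ws) = trans (+-identityˡ _) (sumOver-0 ws)

  shSum : (Word → Carrier) → Word → Word → Carrier
  shSum f a b = sumOver f (shF a b)

  shF-[]ʳ : ∀ a → shF a [] ≡ a ∷ []
  shF-[]ʳ [] = refl
  shF-[]ʳ (u ∷ a) = refl

  shSum-[]ˡ : ∀ f b → shSum f [] b ≈ f b
  shSum-[]ˡ f b = +-identityʳ _

  shSum-[]ʳ : ∀ f a → shSum f a [] ≈ f a
  shSum-[]ʳ f a rewrite shF-[]ʳ a = +-identityʳ _

  shSum-cong : ∀ {f g} → (∀ w → f w ≈ g w) → ∀ a b → shSum f a b ≈ shSum g a b
  shSum-cong f≈g a b = sumOver-cong f≈g (shF a b)

  shSum-+ : ∀ f g a b → shSum (λ w → f w + g w) a b ≈ shSum f a b + shSum g a b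
  shSum-+ f g a b = sumOver-+ f g (shF a b)

  shSum-∷ : ∀ f u a v b → shSum f (u ∷ a) (v ∷ b) ≈
            shSum (λ w → f (u ∷ w)) a (v ∷ b) + shSum (λ w → f (v ∷ w)) (u ∷ a) b
  shSum-∷ f u a v b = trans (sumOver-++ f (map (u ∷_) (shF a (v ∷ b))) (map (v ∷_) (shF (u ∷ a) b)))
    (+-cong (reflexive (sumOver-map f (u ∷_) (shF a (v ∷ b))))
            (reflexive (sumOver-map f (v ∷_) (shF (u ∷ a) b))))

  shSum-comm : ∀ f a b → shSum f a b ≈ shSum f b a
  shSum-comm f [] b = trans (shSum-[]ˡ f b) (sym (shSum-[]ʳ f b))
  shSum-comm f (u ∷ a) [] = ≈-refl
  shSum-comm f (u ∷ a) (v ∷ b) = begin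
    shSum f (u ∷ a) (v ∷ b)                                              ≈⟨ shSum-∷ f u a v b ⟩
    shSum (λ w → f (u ∷ w)) a (v ∷ b) + shSum (λ w → f (v ∷ w)) (u ∷ a) b
      ≈⟨ +-cong (shSum-comm _ a (v ∷ b)) (shSum-comm _ (u ∷ a) b) ⟩
    shSum (λ w → f (u ∷ w)) (v ∷ b) a + shSum (λ w → f (v ∷ w)) b (u ∷ a) ≈⟨ +-comm _ _ ⟩
    shSum (λ w → f (v ∷ w)) b (u ∷ a) + shSum (λ w → f (u ∷ w)) (v ∷ b) a ≈⟨ shSum-∷ f v b u a ⟨
    shSum f (v ∷ b) (u ∷ a)                                              ∎

  -- Both sides of associativity split according to which of the three
  -- words supplies the first letter.
  module _ (f : Word → Carrier) (u v w : Letter) (a b c : Word) where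
    private
      A B C : Word
      A = u ∷ a
      B = v ∷ b
      C = w ∷ c
      fu fv fw : Word → Carrier
      fu z = f (u ∷ z)
      fv z = f (v ∷ z)
      fw z = f (w ∷ z)

    shSum-assocˡ-split : shSum (λ z → shSum f z C) A B ≈
      (shSum (λ z → shSum fu z C) a B + shSum (λ z → shSum fv z C) A b) + shSum (λ z → shSum fw z c) A B
    shSum-assocˡ-split = begin
      shSum (λ z → shSum f z C) A B                                       ≈⟨ shSum-∷ _ u a v b ⟩
      shSum (λ z → shSum f (u ∷ z) C) a B + shSum (λ z → shSum f (v ∷ z) C) A b
        ≈⟨ +-cong (shSum-cong (λ z → shSum-∷ f u z w c) a B) (shSum-cong (λ z → shSum-∷ f v z w c) A b) ⟩
      shSum (λ z → shSum fu z C + shSum fw (u ∷ z) c) a B + shSum (λ z → shSum fv z C + shSum fw (v ∷ z) c) A b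
        ≈⟨ +-cong (shSum-+ _ _ a B) (shSum-+ _ _ A b) ⟩
      (shSum (λ z → shSum fu z C) a B + shSum (λ z → shSum fw (u ∷ z) c) a B) +
        (shSum (λ z → shSum fv z C) A b + shSum (λ z → shSum fw (v ∷ z) c) A b)  ≈⟨ interchange _ _ _ _ ⟩
      (shSum (λ z → shSum fu z C) a B + shSum (λ z → shSum fv z C) A b) +
        (shSum (λ z → shSum fw (u ∷ z) c) a B + shSum (λ z → shSum fw (v ∷ z) c) A b)
        ≈⟨ +-congˡ (shSum-∷ (λ z → shSum fw z c) u a v b) ⟨
      (shSum (λ z → shSum fu z C) a B + shSum (λ z → shSum fv z C) A b) + shSum (λ z → shSum fw z c) A B ∎

    shSum-assocʳ-split : shSum (λ z → shSum f A z) B C ≈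
      (shSum (λ z → shSum fu a z) B C + shSum (λ z → shSum fv A z) b C) + shSum (λ z → shSum fw A z) B c
    shSum-assocʳ-split = begin
      shSum (λ z → shSum f A z) B C                                       ≈⟨ shSum-∷ _ v b w c ⟩
      shSum (λ z → shSum f A (v ∷ z)) b C + shSum (λ z → shSum f A (w ∷ z)) B c
        ≈⟨ +-cong (shSum-cong (λ z → shSum-∷ f u a v z) b C) (shSum-cong (λ z → shSum-∷ f u a w z) B c) ⟩
      shSum (λ z → shSum fu a (v ∷ z) + shSum fv A z) b C + shSum (λ z → shSum fu a (w ∷ z) + shSum fw A z) B c
        ≈⟨ +-cong (shSum-+ _ _ b C) (shSum-+ _ _ B c) ⟩
      (shSum (λ z → shSum fu a (v ∷ z)) b C + shSum (λ z → shSum fv A z) b C) +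
        (shSum (λ z → shSum fu a (w ∷ z)) B c + shSum (λ z → shSum fw A z) B c)  ≈⟨ interchange _ _ _ _ ⟩
      (shSum (λ z → shSum fu a (v ∷ z)) b C + shSum (λ z → shSum fu a (w ∷ z)) B c) +
        (shSum (λ z → shSum fv A z) b C + shSum (λ z → shSum fw A z) B c)
        ≈⟨ +-congʳ (shSum-∷ (λ z → shSum fu a z) v b w c) ⟨
      shSum (λ z → shSum fu a z) B C + (shSum (λ z → shSum fv A z) b C + shSum (λ z → shSum fw A z) B c)
        ≈⟨ +-assoc _ _ _ ⟨
      (shSum (λ z → shSum fu a z) B C + shSum (λ z → shSum fv A z) b C) + shSum (λ z → shSum fw A z) B c ∎

  shSum-assoc : ∀ f a b c → shSum (λ z → shSum f z c) a b ≈ shSum (λ z → shSum f a z) b c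
  shSum-assoc f [] b c =
    trans (shSum-[]ˡ (λ z → shSum f z c) b) (sym (shSum-cong {g = f} (shSum-[]ˡ f) b c))
  shSum-assoc f (u ∷ a) [] c =
    trans (shSum-[]ʳ (λ z → shSum f z c) (u ∷ a)) (sym (shSum-[]ˡ (shSum f (u ∷ a)) c))
  shSum-assoc f (u ∷ a) (v ∷ b) [] =
    trans (shSum-cong {g = f} (shSum-[]ʳ f) (u ∷ a) (v ∷ b)) (sym (shSum-[]ʳ (shSum f (u ∷ a)) (v ∷ b)))
  shSum-assoc f (u ∷ a) (v ∷ b) (w ∷ c) = begin
    _ ≈⟨ shSum-assocˡ-split f u v w a b c ⟩
    _ ≈⟨ +-cong (+-cong (shSum-assoc (λ z → f (u ∷ z)) a (v ∷ b) (w ∷ c))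
                        (shSum-assoc (λ z → f (v ∷ z)) (u ∷ a) b (w ∷ c)))
                (shSum-assoc (λ z → f (w ∷ z)) (u ∷ a) (v ∷ b) c) ⟩
    _ ≈⟨ shSum-assocʳ-split f u v w a b c ⟨
    _ ∎

  onYTail : (Word → Carrier) → Word → Carrier
  onYTail f [] = 0#
  onYTail f (x ∷ w) = 0#
  onYTail f (y l ∷ w) = f w

  onYTail-cong : ∀ {f g} → (∀ w → f w ≈ g w) → ∀ w → onYTail f w ≈ onYTail g w
  onYTail-cong f≈g [] = ≈-refl
  onYTail-cong f≈g (x ∷ w) = ≈-refl
  onYTail-cong f≈g (y l ∷ w) = f≈g w

  shSum-onYTail : ∀ f a b →
    shSum (onYTail f) a b ≈ onYTail (λ a′ → shSum f a′ b) a + onYTail (λ b′ → shSum f a b′) b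
  shSum-onYTail f [] b = trans (shSum-[]ˡ (onYTail f) b)
    (trans (onYTail-cong (λ z → sym (shSum-[]ˡ f z)) b) (sym (+-identityˡ _)))
  shSum-onYTail f (u ∷ a) [] = trans (shSum-[]ʳ (onYTail f) (u ∷ a))
    (trans (onYTail-cong (λ z → sym (shSum-[]ʳ f z)) (u ∷ a)) (sym (+-identityʳ _)))
  shSum-onYTail f (u ∷ a) (v ∷ b) = trans (shSum-∷ _ u a v b) (+-cong (first u) (second v))
    where
      first : ∀ u → shSum (λ z → onYTail f (u ∷ z)) a (v ∷ b) ≈
                    onYTail (λ a′ → shSum f a′ (v ∷ b)) (u ∷ a)
      first x = sumOver-0 (shF a (v ∷ b))
      first (y l) = ≈-refl
      second : ∀ v → shSum (λ z → onYTail f (v ∷ z)) (u ∷ a) b ≈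
                     onYTail (λ b′ → shSum f (u ∷ a) b′) (v ∷ b)
      second x = sumOver-0 (shF (u ∷ a) b)
      second (y l) = ≈-refl

  -- Linear functionals

  lin : (Word → Carrier) → LC → Carrier
  lin f [] = 0#
  lin f ((r , v) ∷ p) = r * f v + lin f p

  lin-++ : ∀ f p q → lin f (p ++ q) ≈ lin f p + lin f q
  lin-++ f [] q = sym (+-identityˡ _)
  lin-++ f ((r , v) ∷ p) q = trans (+-congˡ (lin-++ f p q)) (sym (+-assoc _ _ _))

  lin-scale : ∀ f c p → lin f (scale c p) ≈ c * lin f p
  lin-scale f c [] = sym (zeroʳ c)
  lin-scale f c ((r , v) ∷ p) =
    trans (+-cong (*-assoc c r (f v)) (lin-scale f c p)) (sym (distribˡ c _ _))

  lin-cong : ∀ {f g} → (∀ w → f w ≈ g w) → ∀ p → lin f p ≈ lin g p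
  lin-cong f≈g [] = ≈-refl
  lin-cong f≈g ((r , v) ∷ p) = +-cong (*-congˡ (f≈g v)) (lin-cong f≈g p)

  lin-+ : ∀ f g p → lin (λ w → f w + g w) p ≈ lin f p + lin g p
  lin-+ f g [] = sym (+-identityˡ _)
  lin-+ f g ((r , v) ∷ p) = trans (+-cong (distribˡ r _ _) (lin-+ f g p)) (interchange _ _ _ _)

  lin-0 : ∀ p → lin (λ _ → 0#) p ≈ 0#
  lin-0 [] = ≈-refl
  lin-0 ((r , v) ∷ p) = trans (+-cong (zeroʳ r) (lin-0 p)) (+-identityˡ _)

  lin-*ˡ : ∀ c f p → lin (λ w → c * f w) p ≈ c * lin f p
  lin-*ˡ c f [] = sym (zeroʳ c)
  lin-*ˡ c f ((r , v) ∷ p) =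
    trans (+-cong (trans (sym (*-assoc r c _)) (trans (*-congʳ (*-comm r c)) (*-assoc c r _))) (lin-*ˡ c f p))
          (sym (distribˡ c _ _))

  lin-swap : ∀ (F : Word → Word → Carrier) p q →
             lin (λ v → lin (F v) q) p ≈ lin (λ u → lin (λ v → F v u) p) q
  lin-swap F [] q = sym (lin-0 q)
  lin-swap F ((r , v) ∷ p) q = begin
    r * lin (F v) q + lin (λ v → lin (F v) q) p
      ≈⟨ +-cong (sym (lin-*ˡ r (F v) q)) (lin-swap F p q) ⟩
    lin (λ u → r * F v u) q + lin (λ u → lin (λ v → F v u) p) q ≈⟨ lin-+ _ _ q ⟨
    lin (λ u → r * F v u + lin (λ v → F v u) p) q                ∎

  sumOver-lin : ∀ (F : Word → Word → Carrier) ws q →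
                sumOver (λ w → lin (F w) q) ws ≈ lin (λ u → sumOver (λ w → F w u) ws) q
  sumOver-lin F [] q = sym (lin-0 q)
  sumOver-lin F (w ∷ ws) q = trans (+-congˡ (sumOver-lin F ws q)) (sym (lin-+ _ _ q))

  lin-map : ∀ f c ws → lin f (map (λ w → (c , w)) ws) ≈ c * sumOver f ws
  lin-map f c [] = sym (zeroʳ c)
  lin-map f c (w ∷ ws) = trans (+-congˡ (lin-map f c ws)) (sym (distribˡ c _ _))

  lin-word : ∀ f w → lin f (word w) ≈ f w
  lin-word f w = trans (+-identityʳ _) (*-identityˡ _)

  -- p ≈ₗ q: every linear functional agrees on p and q.  This is equivalent
  -- to ≋ (≈ₗ⇒≋, ≋⇒≈ₗ), but it makes the algebraic laws one-line consequences
  -- of laws for sums over words.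
  record _≈ₗ_ (p q : LC) : Set where
    constructor lin-≈
    field lin-eq : ∀ f → lin f p ≈ lin f q
  open _≈ₗ_ public

  ≈ₗ-refl : ∀ {p} → p ≈ₗ p
  ≈ₗ-refl .lin-eq f = ≈-refl

  ≈ₗ-sym : ∀ {p q} → p ≈ₗ q → q ≈ₗ p
  ≈ₗ-sym p≈q .lin-eq f = sym (p≈q .lin-eq f)

  ≈ₗ-trans : ∀ {p q r} → p ≈ₗ q → q ≈ₗ r → p ≈ₗ r
  ≈ₗ-trans p≈q q≈r .lin-eq f = trans (p≈q .lin-eq f) (q≈r .lin-eq f)

  ++-congₗ : ∀ {p p′ q q′} → p ≈ₗ p′ → q ≈ₗ q′ → (p ++ q) ≈ₗ (p′ ++ q′)
  ++-congₗ {p} {p′} {q} {q′} p≈p′ q≈q′ .lin-eq f =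
    trans (lin-++ f p q) (trans (+-cong (p≈p′ .lin-eq f) (q≈q′ .lin-eq f)) (sym (lin-++ f p′ q′)))

  scale-congₗ : ∀ c {p q} → p ≈ₗ q → scale c p ≈ₗ scale c q
  scale-congₗ c {p} {q} p≈q .lin-eq f =
    trans (lin-scale f c p) (trans (*-congˡ (p≈q .lin-eq f)) (sym (lin-scale f c q)))

  indicator : Word → Word → Carrier
  indicator w v with v ≟W w
  ... | yes _ = 1#
  ... | no _ = 0#

  coeff≈lin-indicator : ∀ w p → coeff w p ≈ lin (indicator w) p
  coeff≈lin-indicator w [] = ≈-refl
  coeff≈lin-indicator w ((r , v) ∷ p) with v ≟W w
  ... | yes _ = +-cong (sym (*-identityʳ r)) (coeff≈lin-indicator w p)
  ... | no _ = trans (coeff≈lin-indicator w p) (sym (trans (+-congʳ (zeroʳ r)) (+-identityˡ _)))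

  ≈ₗ⇒≋ : ∀ {p q} → p ≈ₗ q → p ≋ q
  ≈ₗ⇒≋ {p} {q} p≈q w =
    trans (coeff≈lin-indicator w p) (trans (p≈q .lin-eq (indicator w)) (sym (coeff≈lin-indicator w q)))

  removeWord : Word → LC → LC
  removeWord v [] = []
  removeWord v ((r , u) ∷ p) with u ≟W v
  ... | yes _ = removeWord v p
  ... | no _ = (r , u) ∷ removeWord v p

  lin-removeWord : ∀ f v p → lin f p ≈ coeff v p * f v + lin f (removeWord v p)
  lin-removeWord f v [] = sym (trans (+-congʳ (zeroˡ (f v))) (+-identityˡ _))
  lin-removeWord f v ((r , u) ∷ p) with u ≟W v
  ... | yes refl = trans (+-congˡ (lin-removeWord f v p))
                     (trans (sym (+-assoc _ _ _)) (+-congʳ (sym (distribʳ (f v) r _))))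
  ... | no _ = trans (+-congˡ (lin-removeWord f v p))
                 (trans (sym (+-assoc _ _ _)) (trans (+-congʳ (+-comm _ _)) (+-assoc _ _ _)))

  removeWord-∷ : ∀ r v p → removeWord v ((r , v) ∷ p) ≡ removeWord v p
  removeWord-∷ r v p with v ≟W v
  ... | yes _ = refl
  ... | no v≢v = ⊥-elim (v≢v refl)

  coeff-removeWord-≡ : ∀ v p → coeff v (removeWord v p) ≈ 0#
  coeff-removeWord-≡ v [] = ≈-refl
  coeff-removeWord-≡ v ((r , u) ∷ p) with u ≟W v
  ... | yes _ = coeff-removeWord-≡ v p
  ... | no u≢v with u ≟W v
  ...   | yes u≡v = ⊥-elim (u≢v u≡v)
  ...   | no _ = coeff-removeWord-≡ v p

  coeff-removeWord-≢ : ∀ v w p → ¬ v ≡ w → coeff w (removeWord v p) ≈ coeff w p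
  coeff-removeWord-≢ v w [] v≢w = ≈-refl
  coeff-removeWord-≢ v w ((r , u) ∷ p) v≢w with u ≟W v
  coeff-removeWord-≢ v w ((r , u) ∷ p) v≢w | yes refl with u ≟W w
  ... | yes u≡w = ⊥-elim (v≢w u≡w)
  ... | no _ = coeff-removeWord-≢ v w p v≢w
  coeff-removeWord-≢ v w ((r , u) ∷ p) v≢w | no _ with u ≟W w
  ... | yes _ = +-congˡ (coeff-removeWord-≢ v w p v≢w)
  ... | no _ = coeff-removeWord-≢ v w p v≢w

  removeWord-length : ∀ v p → length (removeWord v p) ℕ.≤ length p
  removeWord-length v [] = z≤n
  removeWord-length v ((r , u) ∷ p) with u ≟W v
  ... | yes _ = ℕP.m≤n⇒m≤1+n (removeWord-length v p)
  ... | no _ = s≤s (removeWord-length v p)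

  coeff-∷-≢ : ∀ r v w p → ¬ v ≡ w → coeff w ((r , v) ∷ p) ≈ coeff w p
  coeff-∷-≢ r v w p v≢w with v ≟W w
  ... | yes v≡w = ⊥-elim (v≢w v≡w)
  ... | no _ = ≈-refl

  -- by induction on the length, removing all occurrences of one word at a time
  lin-≋[] : ∀ f n p → length p ℕ.≤ n → p ≋ [] → lin f p ≈ 0#
  lin-≋[] f n [] _ _ = ≈-refl
  lin-≋[] f (suc n) ((r , v) ∷ p) (s≤s |p|≤n) p≋[] = begin
    lin f ((r , v) ∷ p)                                          ≈⟨ lin-removeWord f v ((r , v) ∷ p) ⟩
    coeff v ((r , v) ∷ p) * f v + lin f (removeWord v ((r , v) ∷ p))
      ≈⟨ +-cong (trans (*-congʳ (p≋[] v)) (zeroˡ _)) (reflexive (cong (lin f) (removeWord-∷ r v p))) ⟩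
    0# + lin f (removeWord v p)                                  ≈⟨ +-identityˡ _ ⟩
    lin f (removeWord v p)
      ≈⟨ lin-≋[] f n (removeWord v p) (ℕP.≤-trans (removeWord-length v p) |p|≤n) rest≋[] ⟩
    0#                                                           ∎
    where
      rest≋[] : removeWord v p ≋ []
      rest≋[] w with v ≟W w
      ... | yes refl = coeff-removeWord-≡ v p
      ... | no v≢w = trans (coeff-removeWord-≢ v w p v≢w) (trans (sym (coeff-∷-≢ r v w p v≢w)) (p≋[] w))

  coeff-++ : ∀ w p q → coeff w (p ++ q) ≈ coeff w p + coeff w q
  coeff-++ w [] q = sym (+-identityˡ _)
  coeff-++ w ((r , v) ∷ p) q with v ≟W w
  ... | yes _ = trans (+-congˡ (coeff-++ w p q)) (sym (+-assoc _ _ _))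
  ... | no _ = coeff-++ w p q

  coeff-scale : ∀ w c p → coeff w (scale c p) ≈ c * coeff w p
  coeff-scale w c [] = sym (zeroʳ c)
  coeff-scale w c ((r , v) ∷ p) with v ≟W w
  ... | yes _ = trans (+-congˡ (coeff-scale w c p)) (sym (distribˡ c r _))
  ... | no _ = coeff-scale w c p

  lin-⊖ : ∀ f p q → lin f (p ⊖ q) ≈ lin f p - lin f q
  lin-⊖ f p q = trans (lin-++ f p _) (+-congˡ (trans (lin-scale f (- 1#) q) (-1*x≈-x _)))

  ≋⇒≈ₗ : ∀ {p q} → p ≋ q → p ≈ₗ q
  ≋⇒≈ₗ {p} {q} p≋q .lin-eq f = x∙y⁻¹≈ε⇒x≈y _ _ (begin
    lin f p - lin f q                                     ≈⟨ lin-⊖ f p q ⟨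
    lin f (p ⊖ q)                                         ≈⟨ lin-≋[] f _ (p ⊖ q) ℕP.≤-refl p⊖q≋[] ⟩
    0#                                                    ∎)
    where
      p⊖q≋[] : (p ⊖ q) ≋ []
      p⊖q≋[] w = trans (coeff-++ w p _) (trans (+-cong (p≋q w) (coeff-scale w (- 1#) q))
                   (trans (+-congˡ (-1*x≈-x _)) (-‿inverseʳ _)))

  shWSum : (Word → Carrier) → Word → Word → Carrier
  shWSum f v u = sumOver f (shW v u)

  shWSum≡shSum : ∀ f v u → shWSum f v u ≡ shSum (λ w → f (reverse w)) (reverse v) (reverse u)
  shWSum≡shSum f v u = sumOver-map f reverse (shF (reverse v) (reverse u))

  shSum-reverse²ˡ : ∀ f a b → shSum f (reverse (reverse a)) b ≈ shSum f a b
  shSum-reverse²ˡ f a b = reflexive (cong (λ a′ → shSum f a′ b) (reverse-involutive a))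

  shSum-reverse²ʳ : ∀ f a b → shSum f a (reverse (reverse b)) ≈ shSum f a b
  shSum-reverse²ʳ f a b = reflexive (cong (shSum f a) (reverse-involutive b))

  shWSum-comm : ∀ f v u → shWSum f v u ≈ shWSum f u v
  shWSum-comm f v u = trans (reflexive (shWSum≡shSum f v u))
    (trans (shSum-comm _ (reverse v) (reverse u)) (sym (reflexive (shWSum≡shSum f u v))))

  shWSum-[]ʳ : ∀ f v → shWSum f v [] ≈ f v
  shWSum-[]ʳ f v = trans (reflexive (shWSum≡shSum f v []))
    (trans (shSum-[]ʳ _ (reverse v)) (reflexive (cong f (reverse-involutive v))))

  shWSum-assoc : ∀ f a b c → sumOver (λ z → shWSum f z c) (shW a b) ≈ sumOver (shWSum f a) (shW b c)
  shWSum-assoc f a b c = begin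
    sumOver (λ z → shWSum f z c) (shW a b)          ≡⟨ sumOver-map _ reverse (shF ra rb) ⟩
    shSum (λ z → shWSum f (reverse z) c) ra rb
      ≈⟨ shSum-cong (λ z → trans (reflexive (shWSum≡shSum f (reverse z) c)) (shSum-reverse²ˡ f′ z rc)) ra rb ⟩
    shSum (λ z → shSum f′ z rc) ra rb               ≈⟨ shSum-assoc f′ ra rb rc ⟩
    shSum (λ z → shSum f′ ra z) rb rc
      ≈⟨ shSum-cong (λ z → trans (reflexive (shWSum≡shSum f a (reverse z))) (shSum-reverse²ʳ f′ ra z)) rb rc ⟨
    shSum (λ z → shWSum f a (reverse z)) rb rc      ≡⟨ sumOver-map _ reverse (shF rb rc) ⟨
    sumOver (shWSum f a) (shW b c)                  ∎
    where
      f′ = λ z → f (reverse z)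
      ra = reverse a
      rb = reverse b
      rc = reverse c

  lin-⧢ : ∀ f p q → lin f (p ⧢ q) ≈ lin (λ v → lin (shWSum f v) q) p
  lin-⧢ f [] q = ≈-refl
  lin-⧢ f ((r , v) ∷ p) q =
    trans (lin-++ f (concatMap (λ b → map (λ w → (r * proj₁ b , w)) (shW v (proj₂ b))) q) (p ⧢ q))
          (+-cong (row q) (lin-⧢ f p q))
    where
      row : ∀ q → lin f (concatMap (λ b → map (λ w → (r * proj₁ b , w)) (shW v (proj₂ b))) q)
                  ≈ r * lin (shWSum f v) q
      row [] = sym (zeroʳ r)
      row ((s , u) ∷ q) = begin
        lin f (map (λ w → (r * s , w)) (shW v u) ++ _) ≈⟨ lin-++ f (map (λ w → (r * s , w)) (shW v u)) _ ⟩
        lin f (map (λ w → (r * s , w)) (shW v u)) + _  ≈⟨ +-cong (lin-map f (r * s) (shW v u)) (row q) ⟩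
        (r * s) * shWSum f v u + r * lin (shWSum f v) q ≈⟨ +-congʳ (*-assoc r s _) ⟩
        r * (s * shWSum f v u) + r * lin (shWSum f v) q ≈⟨ distribˡ r _ _ ⟨
        r * (s * shWSum f v u + lin (shWSum f v) q)     ∎

  ⧢-comm : ∀ p q → (p ⧢ q) ≈ₗ (q ⧢ p)
  ⧢-comm p q .lin-eq f = begin
    lin f (p ⧢ q)                                   ≈⟨ lin-⧢ f p q ⟩
    lin (λ v → lin (shWSum f v) q) p                ≈⟨ lin-swap (shWSum f) p q ⟩
    lin (λ u → lin (λ v → shWSum f v u) p) q
      ≈⟨ lin-cong (λ u → lin-cong (λ v → shWSum-comm f v u) p) q ⟩
    lin (λ u → lin (shWSum f u) p) q                ≈⟨ lin-⧢ f q p ⟨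
    lin f (q ⧢ p)                                   ∎

  ⧢-assoc : ∀ p q s → ((p ⧢ q) ⧢ s) ≈ₗ (p ⧢ (q ⧢ s))
  ⧢-assoc p q s .lin-eq f = begin
    lin f ((p ⧢ q) ⧢ s)                            ≈⟨ lin-⧢ f (p ⧢ q) s ⟩
    lin G (p ⧢ q)                                  ≈⟨ lin-⧢ G p q ⟩
    lin (λ a → lin (λ b → sumOver G (shW a b)) q) p
      ≈⟨ lin-cong (λ a → lin-cong (λ b → sumOver-lin (λ z c → shWSum f z c) (shW a b) s) q) p ⟩
    lin (λ a → lin (λ b → lin (λ c → sumOver (λ z → shWSum f z c) (shW a b)) s) q) p
      ≈⟨ lin-cong (λ a → lin-cong (λ b → lin-cong (λ c → shWSum-assoc f a b c) s) q) p ⟩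
    lin (λ a → lin (λ b → lin (λ c → sumOver (shWSum f a) (shW b c)) s) q) p
      ≈⟨ lin-cong (λ a → lin-⧢ (shWSum f a) q s) p ⟨
    lin (λ a → lin (shWSum f a) (q ⧢ s)) p         ≈⟨ lin-⧢ f p (q ⧢ s) ⟨
    lin f (p ⧢ (q ⧢ s))                            ∎
    where
      G = λ z → lin (shWSum f z) s

  ⧢-identityʳ : ∀ p → (p ⧢ oneLC) ≈ₗ p
  ⧢-identityʳ p .lin-eq f = trans (lin-⧢ f p oneLC)
    (lin-cong (λ v → trans (+-identityʳ _) (trans (*-identityˡ _) (shWSum-[]ʳ f v))) p)

  ⧢-identityˡ : ∀ p → (oneLC ⧢ p) ≈ₗ p
  ⧢-identityˡ p = ≈ₗ-trans (⧢-comm oneLC p) (⧢-identityʳ p)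

  ⧢-zeroʳ : ∀ p → (p ⧢ []) ≈ₗ []
  ⧢-zeroʳ p .lin-eq f = trans (lin-⧢ f p []) (lin-0 p)

  ⧢-distribˡ : ∀ p q s → (p ⧢ (q ++ s)) ≈ₗ ((p ⧢ q) ++ (p ⧢ s))
  ⧢-distribˡ p q s .lin-eq f = begin
    lin f (p ⧢ (q ++ s))                           ≈⟨ lin-⧢ f p (q ++ s) ⟩
    lin (λ v → lin (shWSum f v) (q ++ s)) p        ≈⟨ lin-cong (λ v → lin-++ (shWSum f v) q s) p ⟩
    lin (λ v → lin (shWSum f v) q + lin (shWSum f v) s) p ≈⟨ lin-+ _ _ p ⟩
    lin (λ v → lin (shWSum f v) q) p + lin (λ v → lin (shWSum f v) s) p
      ≈⟨ +-cong (lin-⧢ f p q) (lin-⧢ f p s) ⟨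
    lin f (p ⧢ q) + lin f (p ⧢ s)                  ≈⟨ lin-++ f (p ⧢ q) (p ⧢ s) ⟨
    lin f ((p ⧢ q) ++ (p ⧢ s))                     ∎

  ⧢-distribʳ : ∀ p q s → ((p ++ q) ⧢ s) ≈ₗ ((p ⧢ s) ++ (q ⧢ s))
  ⧢-distribʳ p q s .lin-eq f = begin
    lin f ((p ++ q) ⧢ s)                           ≈⟨ lin-⧢ f (p ++ q) s ⟩
    lin (λ v → lin (shWSum f v) s) (p ++ q)        ≈⟨ lin-++ _ p q ⟩
    lin (λ v → lin (shWSum f v) s) p + lin (λ v → lin (shWSum f v) s) q
      ≈⟨ +-cong (lin-⧢ f p s) (lin-⧢ f q s) ⟨
    lin f (p ⧢ s) + lin f (q ⧢ s)                  ≈⟨ lin-++ f (p ⧢ s) (q ⧢ s) ⟨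
    lin f ((p ⧢ s) ++ (q ⧢ s))                     ∎

  ⧢-scaleˡ : ∀ c p q → (scale c p ⧢ q) ≈ₗ scale c (p ⧢ q)
  ⧢-scaleˡ c p q .lin-eq f = trans (lin-⧢ f (scale c p) q) (trans (lin-scale _ c p)
    (trans (*-congˡ (sym (lin-⧢ f p q))) (sym (lin-scale f c (p ⧢ q)))))

  ⧢-scaleʳ : ∀ c p q → (p ⧢ scale c q) ≈ₗ scale c (p ⧢ q)
  ⧢-scaleʳ c p q .lin-eq f = trans (lin-⧢ f p (scale c q))
    (trans (lin-cong (λ v → lin-scale (shWSum f v) c q) p) (trans (lin-*ˡ c _ p)
    (trans (*-congˡ (sym (lin-⧢ f p q))) (sym (lin-scale f c (p ⧢ q))))))

  ⧢-congˡ : ∀ {p p′} q → p ≈ₗ p′ → (p ⧢ q) ≈ₗ (p′ ⧢ q)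
  ⧢-congˡ {p} {p′} q p≈p′ .lin-eq f =
    trans (lin-⧢ f p q) (trans (p≈p′ .lin-eq _) (sym (lin-⧢ f p′ q)))

  ⧢-congʳ : ∀ p {q q′} → q ≈ₗ q′ → (p ⧢ q) ≈ₗ (p ⧢ q′)
  ⧢-congʳ p {q} {q′} q≈q′ .lin-eq f =
    trans (lin-⧢ f p q) (trans (lin-cong (λ v → q≈q′ .lin-eq (shWSum f v)) p) (sym (lin-⧢ f p q′)))

  -- The derivation ∂

  linExtend : (Word → LC) → LC → LC
  linExtend g [] = []
  linExtend g ((r , v) ∷ p) = scale r (g v) ++ linExtend g p

  lin-linExtend : ∀ f g p → lin f (linExtend g p) ≈ lin (λ v → lin f (g v)) p
  lin-linExtend f g [] = ≈-refl
  lin-linExtend f g ((r , v) ∷ p) =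
    trans (lin-++ f (scale r (g v)) (linExtend g p)) (+-cong (lin-scale f r (g v)) (lin-linExtend f g p))

  -- ∂ʳ works on reversed words, as shF does for shW
  ∂ʳ : Word → LC
  ∂ʳ (y _ ∷ z) = word (reverse z)
  ∂ʳ _ = []

  ∂ : LC → LC
  ∂ = linExtend (λ w → ∂ʳ (reverse w))

  ∂ᵗ : (Word → Carrier) → Word → Carrier
  ∂ᵗ f w = onYTail (λ z → f (reverse z)) (reverse w)

  lin-∂ʳ : ∀ f z → lin f (∂ʳ z) ≈ onYTail (λ z → f (reverse z)) z
  lin-∂ʳ f [] = ≈-refl
  lin-∂ʳ f (x ∷ z) = ≈-refl
  lin-∂ʳ f (y l ∷ z) = lin-word f (reverse z)

  lin-∂ : ∀ f p → lin f (∂ p) ≈ lin (∂ᵗ f) p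
  lin-∂ f p = trans (lin-linExtend f _ p) (lin-cong (λ v → lin-∂ʳ f (reverse v)) p)

  ∂-cong : ∀ {p q} → p ≈ₗ q → ∂ p ≈ₗ ∂ q
  ∂-cong {p} {q} p≈q .lin-eq f = trans (lin-∂ f p) (trans (p≈q .lin-eq (∂ᵗ f)) (sym (lin-∂ f q)))

  ∂-++ : ∀ p q → ∂ (p ++ q) ≈ₗ (∂ p ++ ∂ q)
  ∂-++ p q .lin-eq f = trans (lin-∂ f (p ++ q)) (trans (lin-++ _ p q)
    (sym (trans (lin-++ f (∂ p) (∂ q)) (+-cong (lin-∂ f p) (lin-∂ f q)))))

  ∂-scale : ∀ c p → ∂ (scale c p) ≈ₗ scale c (∂ p)
  ∂-scale c p .lin-eq f = trans (lin-∂ f (scale c p)) (trans (lin-scale _ c p)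
    (sym (trans (lin-scale f c (∂ p)) (*-congˡ (lin-∂ f p)))))

  onYTail-lin : ∀ (F : Word → Word → Carrier) z q →
                onYTail (λ w → lin (F w) q) z ≈ lin (λ b → onYTail (λ w → F w b) z) q
  onYTail-lin F [] q = sym (lin-0 q)
  onYTail-lin F (x ∷ z) q = sym (lin-0 q)
  onYTail-lin F (y l ∷ z) q = ≈-refl

  shWSum-∂ᵗ : ∀ f a b → shWSum (∂ᵗ f) a b ≈ ∂ᵗ (λ v → shWSum f v b) a + ∂ᵗ (shWSum f a) b
  shWSum-∂ᵗ f a b = begin
    shWSum (∂ᵗ f) a b                                       ≡⟨ shWSum≡shSum (∂ᵗ f) a b ⟩
    shSum (λ z → ∂ᵗ f (reverse z)) ra rb
      ≈⟨ shSum-cong (λ z → reflexive (cong (onYTail f′) (reverse-involutive z))) ra rb ⟩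
    shSum (onYTail f′) ra rb                                ≈⟨ shSum-onYTail f′ ra rb ⟩
    onYTail (λ a′ → shSum f′ a′ rb) ra + onYTail (λ b′ → shSum f′ ra b′) rb
      ≈⟨ +-cong (onYTail-cong (λ z → trans (sym (shSum-reverse²ˡ f′ z rb))
                                           (sym (reflexive (shWSum≡shSum f (reverse z) b)))) ra)
                (onYTail-cong (λ z → trans (sym (shSum-reverse²ʳ f′ ra z))
                                           (sym (reflexive (shWSum≡shSum f a (reverse z))))) rb) ⟩
    ∂ᵗ (λ v → shWSum f v b) a + ∂ᵗ (shWSum f a) b          ∎
    where
      f′ = λ z → f (reverse z)
      ra = reverse a
      rb = reverse b

  ∂-⧢ : ∀ p q → ∂ (p ⧢ q) ≈ₗ ((∂ p ⧢ q) ++ (p ⧢ ∂ q))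
  ∂-⧢ p q .lin-eq f = begin
    lin f (∂ (p ⧢ q))                                       ≈⟨ lin-∂ f (p ⧢ q) ⟩
    lin (∂ᵗ f) (p ⧢ q)                                      ≈⟨ lin-⧢ (∂ᵗ f) p q ⟩
    lin (λ a → lin (shWSum (∂ᵗ f) a) q) p
      ≈⟨ lin-cong (λ a → trans (lin-cong (shWSum-∂ᵗ f a) q) (lin-+ _ _ q)) p ⟩
    lin (λ a → lin (λ b → ∂ᵗ (λ v → shWSum f v b) a) q + lin (λ b → ∂ᵗ (shWSum f a) b) q) p
      ≈⟨ lin-+ _ _ p ⟩
    lin (λ a → lin (λ b → ∂ᵗ (λ v → shWSum f v b) a) q) p +
      lin (λ a → lin (λ b → ∂ᵗ (shWSum f a) b) q) p
      ≈⟨ +-cong (lin-cong (λ a → sym (onYTail-lin (λ z b → shWSum f (reverse z) b) (reverse a) q)) p)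
                (lin-cong (λ a → sym (lin-∂ (shWSum f a) q)) p) ⟩
    lin (∂ᵗ (λ v → lin (shWSum f v) q)) p + lin (λ a → lin (shWSum f a) (∂ q)) p
      ≈⟨ +-congʳ (lin-∂ _ p) ⟨
    lin (λ v → lin (shWSum f v) q) (∂ p) + lin (λ a → lin (shWSum f a) (∂ q)) p
      ≈⟨ +-cong (lin-⧢ f (∂ p) q) (lin-⧢ f p (∂ q)) ⟨
    lin f (∂ p ⧢ q) + lin f (p ⧢ ∂ q)                       ≈⟨ lin-++ f (∂ p ⧢ q) (p ⧢ ∂ q) ⟨
    lin f ((∂ p ⧢ q) ++ (p ⧢ ∂ q))                          ∎

  ∂-oneLC : ∂ oneLC ≈ₗ []
  ∂-oneLC .lin-eq f = trans (lin-∂ f oneLC) (trans (+-identityʳ _) (zeroʳ 1#))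

  ∂-y : ∀ m → ∂ (word (y m ∷ [])) ≈ₗ oneLC
  ∂-y m .lin-eq f = lin-∂ f (word (y m ∷ []))

  scale-suc : ∀ n p → (scale (n · 1#) p ++ p) ≈ₗ scale (suc n · 1#) p
  scale-suc n p .lin-eq f = begin
    lin f (scale (n · 1#) p ++ p)                  ≈⟨ lin-++ f (scale (n · 1#) p) p ⟩
    lin f (scale (n · 1#) p) + lin f p             ≈⟨ +-cong (lin-scale f (n · 1#) p) (sym (*-identityˡ _)) ⟩
    (n · 1#) * lin f p + 1# * lin f p              ≈⟨ +-comm _ _ ⟩
    1# * lin f p + (n · 1#) * lin f p              ≈⟨ distribʳ _ 1# (n · 1#) ⟨
    (suc n · 1#) * lin f p                         ≈⟨ lin-scale f (suc n · 1#) p ⟨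
    lin f (scale (suc n · 1#) p)                   ∎

  ∂-shPow : ∀ m n → ∂ (shPow (word (y m ∷ [])) (suc n)) ≈ₗ scale (suc n · 1#) (shPow (word (y m ∷ [])) n)
  ∂-shPow m zero .lin-eq f = begin
    lin f (∂ (oneLC ⧢ Y))                          ≈⟨ ∂-⧢ oneLC Y .lin-eq f ⟩
    lin f ((∂ oneLC ⧢ Y) ++ (oneLC ⧢ ∂ Y))         ≈⟨ lin-++ f (∂ oneLC ⧢ Y) (oneLC ⧢ ∂ Y) ⟩
    lin f (∂ oneLC ⧢ Y) + lin f (oneLC ⧢ ∂ Y)
      ≈⟨ +-cong (⧢-congˡ Y ∂-oneLC .lin-eq f) (≈ₗ-trans (⧢-identityˡ (∂ Y)) (∂-y m) .lin-eq f) ⟩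
    0# + lin f oneLC                               ≈⟨ +-identityˡ _ ⟩
    lin f oneLC                                    ≈⟨ trans (*-congʳ (+-identityʳ 1#)) (*-identityˡ _) ⟨
    (1 · 1#) * lin f oneLC                         ≈⟨ lin-scale f (1 · 1#) oneLC ⟨
    lin f (scale (1 · 1#) oneLC)                   ∎
    where Y = word (y m ∷ [])
  ∂-shPow m (suc n) .lin-eq f = begin
    lin f (∂ (Yⁿ⁺¹ ⧢ Y))                           ≈⟨ ∂-⧢ Yⁿ⁺¹ Y .lin-eq f ⟩
    lin f ((∂ Yⁿ⁺¹ ⧢ Y) ++ (Yⁿ⁺¹ ⧢ ∂ Y))           ≈⟨ lin-++ f (∂ Yⁿ⁺¹ ⧢ Y) (Yⁿ⁺¹ ⧢ ∂ Y) ⟩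
    lin f (∂ Yⁿ⁺¹ ⧢ Y) + lin f (Yⁿ⁺¹ ⧢ ∂ Y)
      ≈⟨ +-cong (≈ₗ-trans (⧢-congˡ Y (∂-shPow m n)) (⧢-scaleˡ (suc n · 1#) (shPow Y n) Y) .lin-eq f)
                (≈ₗ-trans (⧢-congʳ Yⁿ⁺¹ (∂-y m)) (⧢-identityʳ Yⁿ⁺¹) .lin-eq f) ⟩
    lin f (scale (suc n · 1#) Yⁿ⁺¹) + lin f Yⁿ⁺¹   ≈⟨ lin-++ f (scale (suc n · 1#) Yⁿ⁺¹) Yⁿ⁺¹ ⟨
    lin f (scale (suc n · 1#) Yⁿ⁺¹ ++ Yⁿ⁺¹)        ≈⟨ scale-suc (suc n) Yⁿ⁺¹ .lin-eq f ⟩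
    lin f (scale (suc (suc n) · 1#) Yⁿ⁺¹)          ∎
    where
      Y = word (y m ∷ [])
      Yⁿ⁺¹ = shPow Y (suc n)

  -- ψ is a homomorphism

  _≈ₚ_ : Poly → Poly → Set
  P ≈ₚ Q = ∀ j → pcoeff j P ≈ₗ pcoeff j Q

  ≋P⇒≈ₚ : ∀ P Q → P ≋P Q → P ≈ₚ Q
  ≋P⇒≈ₚ P Q P≋Q j = ≋⇒≈ₗ {pcoeff j P} (P≋Q j)

  ≈ₚ⇒≋P : ∀ P Q → P ≈ₚ Q → P ≋P Q
  ≈ₚ⇒≋P P Q P≈Q j = ≈ₗ⇒≋ (P≈Q j)

  module _ (m : ℚ) where
    private
      Y : LC
      Y = word (y m ∷ [])
      Y^ : ℕ → LC
      Y^ = shPow Y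

    ψFrom-padd : ∀ i P Q → ψFrom m i (padd P Q) ≈ₗ (ψFrom m i P ++ ψFrom m i Q)
    ψFrom-padd i [] Q = ≈ₗ-refl
    ψFrom-padd i (a ∷ P) [] .lin-eq f = sym (trans (lin-++ f (ψFrom m i (a ∷ P)) []) (+-identityʳ _))
    ψFrom-padd i (a ∷ P) (b ∷ Q) .lin-eq f = begin
      lin f (((a ++ b) ⧢ Y^ i) ++ ψFrom m (suc i) (padd P Q))    ≈⟨ lin-++ f ((a ++ b) ⧢ Y^ i) _ ⟩
      lin f ((a ++ b) ⧢ Y^ i) + lin f (ψFrom m (suc i) (padd P Q))
        ≈⟨ +-cong (trans (⧢-distribʳ a b (Y^ i) .lin-eq f) (lin-++ f (a ⧢ Y^ i) (b ⧢ Y^ i)))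
                  (trans (ψFrom-padd (suc i) P Q .lin-eq f) (lin-++ f (ψFrom m (suc i) P) _)) ⟩
      (lin f (a ⧢ Y^ i) + lin f (b ⧢ Y^ i)) + (lin f (ψFrom m (suc i) P) + lin f (ψFrom m (suc i) Q))
        ≈⟨ interchange _ _ _ _ ⟩
      (lin f (a ⧢ Y^ i) + lin f (ψFrom m (suc i) P)) + (lin f (b ⧢ Y^ i) + lin f (ψFrom m (suc i) Q))
        ≈⟨ +-cong (lin-++ f (a ⧢ Y^ i) _) (lin-++ f (b ⧢ Y^ i) _) ⟨
      lin f (ψFrom m i (a ∷ P)) + lin f (ψFrom m i (b ∷ Q))     ≈⟨ lin-++ f (ψFrom m i (a ∷ P)) _ ⟨
      lin f (ψFrom m i (a ∷ P) ++ ψFrom m i (b ∷ Q))            ∎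

    ψFrom-suc : ∀ i P → ψFrom m (suc i) P ≈ₗ (ψFrom m i P ⧢ Y)
    ψFrom-suc i [] = ≈ₗ-refl
    ψFrom-suc i (a ∷ P) =
      ≈ₗ-trans (++-congₗ (≈ₗ-sym (⧢-assoc a (Y^ i) Y)) (ψFrom-suc (suc i) P))
               (≈ₗ-sym (⧢-distribʳ (a ⧢ Y^ i) (ψFrom m (suc i) P) Y))

    ψFrom≈ψ⧢shPow : ∀ i P → ψFrom m i P ≈ₗ (ψ m P ⧢ Y^ i)
    ψFrom≈ψ⧢shPow zero P = ≈ₗ-sym (⧢-identityʳ (ψ m P))
    ψFrom≈ψ⧢shPow (suc i) P =
      ≈ₗ-trans (ψFrom-suc i P) (≈ₗ-trans (⧢-congˡ Y (ψFrom≈ψ⧢shPow i P)) (⧢-assoc (ψ m P) (Y^ i) Y))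

    ψFrom-map⧢ : ∀ i a Q → ψFrom m i (map (a ⧢_) Q) ≈ₗ (a ⧢ ψFrom m i Q)
    ψFrom-map⧢ i a [] = ≈ₗ-sym (⧢-zeroʳ a)
    ψFrom-map⧢ i a (b ∷ Q) =
      ≈ₗ-trans (++-congₗ (⧢-assoc a b (Y^ i)) (ψFrom-map⧢ (suc i) a Q))
               (≈ₗ-sym (⧢-distribˡ a (b ⧢ Y^ i) (ψFrom m (suc i) Q)))

    ψFrom-pmul : ∀ i P Q → ψFrom m i (pmul P Q) ≈ₗ (ψFrom m i P ⧢ ψ m Q)
    ψFrom-pmul i [] Q = ≈ₗ-refl
    ψFrom-pmul i (a ∷ P) Q =
      ≈ₗ-trans (ψFrom-padd i (map (a ⧢_) Q) ([] ∷ pmul P Q))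
      (≈ₗ-trans (++-congₗ (ψFrom-map⧢ i a Q) (ψFrom-pmul (suc i) P Q))
      (≈ₗ-trans (++-congₗ a⧢ψQYⁱ ≈ₗ-refl)
                (≈ₗ-sym (⧢-distribʳ (a ⧢ Y^ i) (ψFrom m (suc i) P) (ψ m Q)))))
      where
        a⧢ψQYⁱ : (a ⧢ ψFrom m i Q) ≈ₗ ((a ⧢ Y^ i) ⧢ ψ m Q)
        a⧢ψQYⁱ = ≈ₗ-trans (⧢-congʳ a (≈ₗ-trans (ψFrom≈ψ⧢shPow i Q) (⧢-comm (ψ m Q) (Y^ i))))
                          (≈ₗ-sym (⧢-assoc a (Y^ i) (ψ m Q)))

    ψFrom-[]≈ₚ : ∀ i Q → [] ≈ₚ Q → [] ≈ₗ ψFrom m i Q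
    ψFrom-[]≈ₚ i [] _ = ≈ₗ-refl
    ψFrom-[]≈ₚ i (b ∷ Q) []≈Q = ≈ₗ-trans (ψFrom-[]≈ₚ (suc i) Q (λ j → []≈Q (suc j)))
                                         (++-congₗ (⧢-congˡ (Y^ i) ([]≈Q 0)) ≈ₗ-refl)

    ψFrom-cong : ∀ i P Q → P ≈ₚ Q → ψFrom m i P ≈ₗ ψFrom m i Q
    ψFrom-cong i [] Q P≈Q = ψFrom-[]≈ₚ i Q P≈Q
    ψFrom-cong i (a ∷ P) [] P≈Q = ≈ₗ-sym (ψFrom-[]≈ₚ i (a ∷ P) (λ j → ≈ₗ-sym (P≈Q j)))
    ψFrom-cong i (a ∷ P) (b ∷ Q) P≈Q =
      ++-congₗ (⧢-congˡ (Y^ i) (P≈Q 0)) (ψFrom-cong (suc i) P Q (λ j → P≈Q (suc j)))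

    ψ-pconst : ∀ a → ψ m (pconst a) ≈ₗ a
    ψ-pconst a .lin-eq f = trans (lin-++ f (a ⧢ oneLC) []) (trans (+-identityʳ _) (⧢-identityʳ a .lin-eq f))

  -- R⟨X⟩¹, R⟨X⟩⁰ and ker ∂

  AllWord1 : LC → Set
  AllWord1 = All (λ e → Word1 (proj₂ e))

  AllWord1-scale : ∀ c {p} → AllWord1 p → AllWord1 (scale c p)
  AllWord1-scale c = AllP.map⁺

  AllWord1-⧢ : ∀ {p q} → AllWord1 p → AllWord1 q → AllWord1 (p ⧢ q)
  AllWord1-⧢ {[]} [] _ = []
  AllWord1-⧢ {(r , v) ∷ p} {q} (wv ∷ wp) wq = AllP.++⁺ (row wq) (AllWord1-⧢ wp wq)
    where
      row : ∀ {q} → AllWord1 q →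
            AllWord1 (concatMap (λ b → map (λ w → (r * proj₁ b , w)) (shW v (proj₂ b))) q)
      row [] = []
      row {(s , u) ∷ q} (wu ∷ wq) = AllP.++⁺ (AllP.map⁺ (Word1-shW v u wv wu)) (row wq)

  In1ₗ : LC → Set
  In1ₗ p = Σ LC λ L → AllWord1 L × (p ≈ₗ L)

  In1ₗ⇒In1 : ∀ {p} → In1ₗ p → In1 p
  In1ₗ⇒In1 (L , wL , p≈L) = L , wL , ≈ₗ⇒≋ p≈L

  In1ₗ-word : ∀ w → Word1 w → In1ₗ (word w)
  In1ₗ-word w ww = word w , ww ∷ [] , ≈ₗ-refl

  In1ₗ-++ : ∀ {p q} → In1ₗ p → In1ₗ q → In1ₗ (p ++ q)
  In1ₗ-++ (L₁ , w₁ , p≈L₁) (L₂ , w₂ , q≈L₂) = L₁ ++ L₂ , AllP.++⁺ w₁ w₂ , ++-congₗ p≈L₁ q≈L₂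

  In1ₗ-⧢ : ∀ {p q} → In1ₗ p → In1ₗ q → In1ₗ (p ⧢ q)
  In1ₗ-⧢ {q = q} (L₁ , w₁ , p≈L₁) (L₂ , w₂ , q≈L₂) =
    L₁ ⧢ L₂ , AllWord1-⧢ w₁ w₂ , ≈ₗ-trans (⧢-congˡ q p≈L₁) (⧢-congʳ L₁ q≈L₂)

  combination : List (Carrier × LC) → LC
  combination = concatMap (λ e → scale (proj₁ e) (proj₂ e))

  AllGen0 : List (Carrier × LC) → Set
  AllGen0 = All (λ e → Gen0 (proj₂ e))

  In0ₗ : LC → Set
  In0ₗ p = Σ (List (Carrier × LC)) λ G → AllGen0 G × (p ≈ₗ combination G)

  In0⇒In0ₗ : ∀ {p} → In0 p → In0ₗ p
  In0⇒In0ₗ (G , gG , p≋G) = G , gG , ≋⇒≈ₗ p≋G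

  In0ₗ⇒In0 : ∀ {p} → In0ₗ p → In0 p
  In0ₗ⇒In0 (G , gG , p≈G) = G , gG , ≈ₗ⇒≋ p≈G

  lin-combination-∷ : ∀ f c g G → lin f (combination ((c , g) ∷ G)) ≈ c * lin f g + lin f (combination G)
  lin-combination-∷ f c g G = trans (lin-++ f (scale c g) (combination G)) (+-congʳ (lin-scale f c g))

  lin-combination-++ : ∀ f G H → lin f (combination (G ++ H)) ≈ lin f (combination G) + lin f (combination H)
  lin-combination-++ f G H =
    trans (reflexive (cong (lin f) (concatMap-++ (λ e → scale (proj₁ e) (proj₂ e)) G H)))
          (lin-++ f (combination G) (combination H))

  combination-scale : ∀ c G → combination (map (λ e → (c * proj₁ e , proj₂ e)) G) ≈ₗ scale c (combination G)
  combination-scale c [] = ≈ₗ-refl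
  combination-scale c ((r , g) ∷ G) .lin-eq f = begin
    lin f (combination ((c * r , g) ∷ cG))             ≈⟨ lin-combination-∷ f (c * r) g cG ⟩
    (c * r) * lin f g + lin f (combination cG)
      ≈⟨ +-cong (*-assoc c r _) (trans (combination-scale c G .lin-eq f) (lin-scale f c (combination G))) ⟩
    c * (r * lin f g) + c * lin f (combination G)      ≈⟨ distribˡ c _ _ ⟨
    c * (r * lin f g + lin f (combination G))          ≈⟨ *-congˡ (lin-combination-∷ f r g G) ⟨
    c * lin f (combination ((r , g) ∷ G))              ≈⟨ lin-scale f c (combination ((r , g) ∷ G)) ⟨
    lin f (scale c (combination ((r , g) ∷ G)))        ∎
    where cG = map (λ e → (c * proj₁ e , proj₂ e)) G

  In0-scale : ∀ c {p} → In0 p → In0 (scale c p)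
  In0-scale c {p} (G , gG , p≋G) = In0ₗ⇒In0
    (map (λ e → (c * proj₁ e , proj₂ e)) G , AllP.map⁺ gG ,
     ≈ₗ-trans (scale-congₗ c (≋⇒≈ₗ {p} p≋G)) (≈ₗ-sym (combination-scale c G)))

  Gen0⇒AllWord1 : ∀ {g} → Gen0 g → AllWord1 g
  Gen0⇒AllWord1 gen-one = (tt , tt) ∷ []
  Gen0⇒AllWord1 (gen-adm ks (pos , _)) = Word1-yx ks pos ∷ []
  Gen0⇒AllWord1 (gen-dif ps a b pos 0<a 0<b _) =
    Word1-yx _ (AllP.++⁺ pos ((s≤s z≤n , 0<a) ∷ [])) ∷ Word1-yx _ (AllP.++⁺ pos ((s≤s z≤n , 0<b) ∷ [])) ∷ []

  combination-AllWord1 : ∀ {G} → AllGen0 G → AllWord1 (combination G)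
  combination-AllWord1 [] = []
  combination-AllWord1 {(c , g) ∷ G} (gg ∷ gG) =
    AllP.++⁺ (AllWord1-scale c (Gen0⇒AllWord1 gg)) (combination-AllWord1 gG)

  In0ₗ⇒In1ₗ : ∀ {p} → In0ₗ p → In1ₗ p
  In0ₗ⇒In1ₗ (G , gG , p≈G) = combination G , combination-AllWord1 gG , p≈G

  ∂ᵗ-∷ʳ-y : ∀ f u l → ∂ᵗ f (u ++ y l ∷ []) ≈ f u
  ∂ᵗ-∷ʳ-y f u l rewrite reverse-++ u (y l ∷ []) = reflexive (cong f (reverse-involutive u))

  ∂ᵗ-∷ʳ-x : ∀ f u → ∂ᵗ f (u ++ x ∷ []) ≈ 0#
  ∂ᵗ-∷ʳ-x f u rewrite reverse-++ u (x ∷ []) = ≈-refl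

  x^suc : ∀ j → replicate (suc j) x ≡ replicate j x ++ x ∷ []
  x^suc zero = refl
  x^suc (suc j) = cong (x ∷_) (x^suc j)

  ∂-Gen0 : ∀ {g} → Gen0 g → ∂ g ≈ₗ []
  ∂-Gen0 gen-one = ∂-oneLC
  ∂-Gen0 (gen-adm _ (_ , ps , suc (suc j) , m , refl , s≤s (s≤s _))) .lin-eq f =
    trans (lin-∂ f (word wk)) (trans (lin-word (∂ᵗ f) wk)
      (subst (λ w → ∂ᵗ f w ≈ 0#) (≡.sym ends-with-x) (∂ᵗ-∷ʳ-x f (yx ps ++ y d ∷ replicate j x))))
    where
      wk = yx (ps ++ (suc (suc j) , m) ∷ [])
      d = m ℚ.- finalM 0ℚ ps
      ends-with-x : wk ≡ (yx ps ++ y d ∷ replicate j x) ++ x ∷ []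
      ends-with-x = ≡.trans (yxFrom-snoc 0ℚ ps (suc (suc j)) m)
        (≡.trans (cong (λ t → yx ps ++ y d ∷ t) (x^suc j))
                 (≡.sym (++-assoc (yx ps) (y d ∷ replicate j x) (x ∷ []))))
  ∂-Gen0 (gen-dif ps a b _ _ _ _) .lin-eq f = begin
    lin f (∂ (word (w a) ⊖ word (w b)))                 ≈⟨ lin-∂ f (word (w a) ⊖ word (w b)) ⟩
    lin (∂ᵗ f) (word (w a) ⊖ word (w b))                ≈⟨ lin-⊖ (∂ᵗ f) (word (w a)) (word (w b)) ⟩
    lin (∂ᵗ f) (word (w a)) - lin (∂ᵗ f) (word (w b))
      ≈⟨ +-congˡ (-‿cong (trans (lin-word (∂ᵗ f) (w b)) (∂ᵗ-w b))) ⟩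
    lin (∂ᵗ f) (word (w a)) - f (yx ps)
      ≈⟨ +-congʳ (trans (lin-word (∂ᵗ f) (w a)) (∂ᵗ-w a)) ⟩
    f (yx ps) - f (yx ps)                               ≈⟨ -‿inverseʳ _ ⟩
    0#                                                  ∎
    where
      w = λ c → yx (ps ++ (1 , c) ∷ [])
      ∂ᵗ-w : ∀ c → ∂ᵗ f (w c) ≈ f (yx ps)
      ∂ᵗ-w c = subst (λ t → ∂ᵗ f t ≈ f (yx ps)) (≡.sym (yxFrom-snoc 0ℚ ps 1 c)) (∂ᵗ-∷ʳ-y f (yx ps) _)

  ∂-combination : ∀ {G} → AllGen0 G → ∂ (combination G) ≈ₗ []
  ∂-combination [] = ≈ₗ-refl
  ∂-combination {(c , g) ∷ G} (gg ∷ gG) .lin-eq f = begin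
    lin f (∂ (scale c g ++ combination G))             ≈⟨ ∂-++ (scale c g) (combination G) .lin-eq f ⟩
    lin f (∂ (scale c g) ++ ∂ (combination G))         ≈⟨ lin-++ f (∂ (scale c g)) _ ⟩
    lin f (∂ (scale c g)) + lin f (∂ (combination G))
      ≈⟨ +-cong (trans (∂-scale c g .lin-eq f) (trans (lin-scale f c (∂ g)) (*-congˡ (∂-Gen0 gg .lin-eq f))))
                (∂-combination gG .lin-eq f) ⟩
    c * 0# + 0#                                        ≈⟨ trans (+-identityʳ _) (zeroʳ c) ⟩
    0#                                                 ∎

  ∂-In0ₗ : ∀ {p} → In0ₗ p → ∂ p ≈ₗ []
  ∂-In0ₗ (G , gG , p≈G) = ≈ₗ-trans (∂-cong p≈G) (∂-combination gG)

  -- a section of ∂ on words, with values in R⟨X⟩¹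
  canonical : Word → LC
  canonical u = word (u ++ y (1ℚ ℚ.- ySum 0ℚ u) ∷ [])

  canonicalᵗ : (Word → Carrier) → Word → Carrier
  canonicalᵗ f v = lin f (canonical v)

  -- r·w ≡ r·canonical(∂ w) modulo R⟨X⟩⁰, stated against all functionals f
  Decomposition : Carrier → Word → Set
  Decomposition r w = Σ (List (Carrier × LC)) λ G → AllGen0 G ×
    (∀ f → r * f w ≈ lin f (combination G) + r * ∂ᵗ (canonicalᵗ f) w)

  lin-combination-singleton : ∀ f c g → lin f (combination ((c , g) ∷ [])) ≈ c * lin f g
  lin-combination-singleton f c g = trans (lin-combination-∷ f c g []) (+-identityʳ _)

  decomposition-Gen0 : ∀ r {g} → Gen0 g → ∀ {w} → (∀ f → lin f g ≈ f w) →
                       (∀ f → ∂ᵗ (canonicalᵗ f) w ≈ 0#) → Decomposition r w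
  decomposition-Gen0 r {g} gg {w} g≈w ∂w≈0 = (r , g) ∷ [] , gg ∷ [] , λ f → begin
    r * f w                                       ≈⟨ *-congˡ (g≈w f) ⟨
    r * lin f g                                   ≈⟨ lin-combination-singleton f r g ⟨
    lin f (combination ((r , g) ∷ []))            ≈⟨ +-identityʳ _ ⟨
    lin f (combination ((r , g) ∷ [])) + 0#       ≈⟨ +-congˡ (trans (*-congˡ (∂w≈0 f)) (zeroʳ r)) ⟨
    lin f (combination ((r , g) ∷ [])) + r * ∂ᵗ (canonicalᵗ f) w ∎

  yx-∷ʳ-1 : ∀ {ps u} → yx ps ≡ u → finalM 0ℚ ps ≡ ySum 0ℚ u →
            ∀ c → yx (ps ++ (1 , c) ∷ []) ≡ u ++ y (c ℚ.- ySum 0ℚ u) ∷ []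
  yx-∷ʳ-1 {ps} refl ps-final c =
    ≡.trans (yxFrom-snoc 0ℚ ps 1 c) (cong (λ s → yx ps ++ y (c ℚ.- s) ∷ []) ps-final)

  decomposition-∷ʳy : ∀ r u l → Word1 (u ++ y l ∷ []) → Decomposition r (u ++ y l ∷ [])
  decomposition-∷ʳy r u l wul with Word1⇒positive-yx u (Word1-prefix u (y l ∷ []) wul)
  ... | ps , pos , ps-word , ps-final with (ySum 0ℚ u ℚ.+ l) ℚP.≟ 1ℚ
  ...   | yes S+l≡1 = [] , [] , λ f → begin
          r * f (u ++ y l ∷ [])                   ≈⟨ *-congˡ (reflexive (cong f canonical-word)) ⟩
          r * f cw
            ≈⟨ *-congˡ (trans (∂ᵗ-∷ʳ-y (canonicalᵗ f) u l) (lin-word f cw)) ⟨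
          r * ∂ᵗ (canonicalᵗ f) (u ++ y l ∷ [])  ≈⟨ +-identityˡ _ ⟨
          0# + r * ∂ᵗ (canonicalᵗ f) (u ++ y l ∷ []) ∎
    where
      cw = u ++ y (1ℚ ℚ.- ySum 0ℚ u) ∷ []
      canonical-word : u ++ y l ∷ [] ≡ cw
      canonical-word = cong (λ t → u ++ y t ∷ [])
        (≡.trans (≡.sym ([m+n]-m≡n (ySum 0ℚ u) l)) (cong (ℚ._- ySum 0ℚ u) S+l≡1))
  ...   | no S+l≢1 = (r , g) ∷ [] , gen-dif ps (S ℚ.+ l) 1ℚ pos 0<S+l (ℚP.positive⁻¹ 1ℚ) S+l≢1 ∷ [] ,
          λ f → begin
          r * f w                                 ≈⟨ *-congˡ (//-rightDividesˡ (f cw) (f w)) ⟨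
          r * (f w - f cw + f cw)                 ≈⟨ distribˡ r _ _ ⟩
          r * (f w - f cw) + r * f cw
            ≈⟨ +-cong (trans (lin-combination-singleton f r g) (*-congˡ (lin-g f)))
                      (*-congˡ (trans (∂ᵗ-∷ʳ-y (canonicalᵗ f) u l) (lin-word f cw))) ⟨
          lin f (combination ((r , g) ∷ [])) + r * ∂ᵗ (canonicalᵗ f) w ∎
    where
      S = ySum 0ℚ u
      w = u ++ y l ∷ []
      cw = u ++ y (1ℚ ℚ.- S) ∷ []
      0<S+l : 0ℚ ℚ.< S ℚ.+ l
      0<S+l = GoodFrom-last 0ℚ u l (proj₂ wul)
      first = yx (ps ++ (1 , S ℚ.+ l) ∷ [])
      second = yx (ps ++ (1 , 1ℚ) ∷ [])
      g = word first ⊖ word second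
      lin-g : ∀ f → lin f g ≈ f w - f cw
      lin-g f = trans (lin-⊖ f (word first) (word second))
        (+-cong (trans (lin-word f first) (reflexive (cong f first≡w)))
                (-‿cong (trans (lin-word f second) (reflexive (cong f second≡cw)))))
        where
          first≡w : first ≡ w
          first≡w = ≡.trans (yx-∷ʳ-1 ps-word ps-final (S ℚ.+ l)) (cong (λ t → u ++ y t ∷ []) ([m+n]-m≡n S l))
          second≡cw : second ≡ cw
          second≡cw = yx-∷ʳ-1 ps-word ps-final 1ℚ

  decomposition : ∀ r w → Word1 w → Decomposition r w
  decomposition r w ww with reverseView w
  ... | [] = decomposition-Gen0 r gen-one (λ f → lin-word f []) (λ f → ≈-refl)
  ... | u ∶ _ ∶ʳ x with Word1-∷ʳx⇒admissible-yx u ww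
  ...   | ks , adm , ks-word =
          decomposition-Gen0 r (gen-adm ks adm)
            (λ f → trans (lin-word f (yx ks)) (reflexive (cong f ks-word))) (λ f → ∂ᵗ-∷ʳ-x (canonicalᵗ f) u)
  decomposition r w ww | u ∶ _ ∶ʳ y l = decomposition-∷ʳy r u l ww

  decomposition-AllWord1 : ∀ {L} → AllWord1 L → Σ (List (Carrier × LC)) λ G → AllGen0 G ×
    (∀ f → lin f L ≈ lin f (combination G) + lin (∂ᵗ (canonicalᵗ f)) L)
  decomposition-AllWord1 [] = [] , [] , λ f → sym (+-identityʳ 0#)
  decomposition-AllWord1 {(r , w) ∷ L} (ww ∷ wL)
    with decomposition r w ww | decomposition-AllWord1 wL
  ... | G , gG , eqG | H , gH , eqH = G ++ H , AllP.++⁺ gG gH , λ f → begin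
    r * f w + lin f L                             ≈⟨ +-cong (eqG f) (eqH f) ⟩
    (lin f (combination G) + r * ∂ᵗ (canonicalᵗ f) w) + (lin f (combination H) + lin (∂ᵗ (canonicalᵗ f)) L)
      ≈⟨ interchange _ _ _ _ ⟩
    (lin f (combination G) + lin f (combination H)) + (r * ∂ᵗ (canonicalᵗ f) w + lin (∂ᵗ (canonicalᵗ f)) L)
      ≈⟨ +-congʳ (lin-combination-++ f G H) ⟨
    lin f (combination (G ++ H)) + lin (∂ᵗ (canonicalᵗ f)) ((r , w) ∷ L) ∎

  ∂-kernel : ∀ {L} → AllWord1 L → ∂ L ≈ₗ [] → In0ₗ L
  ∂-kernel {L} wL ∂L≈0 with decomposition-AllWord1 wL
  ... | G , gG , eqG = G , gG , lin-≈ λ f →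
    trans (eqG f) (trans (+-congˡ (trans (sym (lin-∂ (canonicalᵗ f) L)) (∂L≈0 .lin-eq (canonicalᵗ f))))
                         (+-identityʳ _))

  scale-scale : ∀ c d p → scale c (scale d p) ≈ₗ scale (c * d) p
  scale-scale c d p .lin-eq f =
    trans (lin-scale f c (scale d p))
      (trans (*-congˡ (lin-scale f d p)) (trans (sym (*-assoc c d _)) (sym (lin-scale f (c * d) p))))

  scale-1# : ∀ {c} p → c ≈ 1# → scale c p ≈ₗ p
  scale-1# p c≈1 .lin-eq f = trans (lin-scale f _ p) (trans (*-congʳ c≈1) (*-identityˡ _))

  ++-cancelʳₗ : ∀ {p q r s} → (p ++ r) ≈ₗ (q ++ s) → r ≈ₗ s → p ≈ₗ q
  ++-cancelʳₗ {p} {q} {r} {s} p+r≈q+s r≈s .lin-eq f = begin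
    lin f p                                 ≈⟨ //-rightDividesʳ (lin f r) (lin f p) ⟨
    lin f p + lin f r - lin f r
      ≈⟨ +-cong (trans (sym (lin-++ f p r)) (p+r≈q+s .lin-eq f)) (-‿cong (r≈s .lin-eq f)) ⟩
    lin f (q ++ s) - lin f s                ≈⟨ +-congʳ (lin-++ f q s) ⟩
    lin f q + lin f s - lin f s             ≈⟨ //-rightDividesʳ (lin f s) (lin f q) ⟩
    lin f q                                 ∎

  ⊖-self : ∀ {p q} → p ≈ₗ q → (p ⊖ q) ≈ₗ []
  ⊖-self {p} {q} p≈q .lin-eq f = trans (lin-⊖ f p q) (x≈y⇒x∙y⁻¹≈ε (p≈q .lin-eq f))

  ⊖-++-cancel : ∀ p q → ((p ⊖ q) ++ q) ≈ₗ p
  ⊖-++-cancel p q .lin-eq f =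
    trans (lin-++ f (p ⊖ q) q) (trans (+-congʳ (lin-⊖ f p q)) (//-rightDividesˡ (lin f q) (lin f p)))

  ∂-⊖ : ∀ p q → ∂ (p ⊖ q) ≈ₗ (∂ p ⊖ ∂ q)
  ∂-⊖ p q = ≈ₗ-trans (∂-++ p _) (++-congₗ ≈ₗ-refl (∂-scale (- 1#) q))

  ∂-⧢-In0ₗ : ∀ {p} → In0ₗ p → ∀ q → ∂ (p ⧢ q) ≈ₗ (p ⧢ ∂ q)
  ∂-⧢-In0ₗ {p} p0 q = ≈ₗ-trans (∂-⧢ p q) (++-congₗ (⧢-congˡ q (∂-In0ₗ p0)) ≈ₗ-refl)

  -- Formal derivative

  -- multiplies the coefficient of T^j by k + j + 1
  weightFrom : ℕ → Poly → Poly
  weightFrom k [] = []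
  weightFrom k (b ∷ P) = scale (suc k · 1#) b ∷ weightFrom (suc k) P

  derivative : Poly → Poly
  derivative P = weightFrom 0 (drop 1 P)

  Poly0-weightFrom : ∀ k {P} → Poly0 P → Poly0 (weightFrom k P)
  Poly0-weightFrom k [] = []
  Poly0-weightFrom k {b ∷ P} (b0 ∷ P0) = In0-scale (suc k · 1#) {b} b0 ∷ Poly0-weightFrom (suc k) P0

  length-weightFrom : ∀ k P → length (weightFrom k P) ≡ length P
  length-weightFrom k [] = refl
  length-weightFrom k (b ∷ P) = cong suc (length-weightFrom (suc k) P)

  pcoeff-suc : ∀ j P → pcoeff (suc j) P ≡ pcoeff j (drop 1 P)
  pcoeff-suc j [] = refl
  pcoeff-suc j (a ∷ P) = refl

  pcoeff-zero-weightFrom : ∀ k P → pcoeff 0 (weightFrom k P) ≡ scale (suc k · 1#) (pcoeff 0 P)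
  pcoeff-zero-weightFrom k [] = refl
  pcoeff-zero-weightFrom k (b ∷ P) = refl

  drop-weightFrom : ∀ k P → drop 1 (weightFrom k P) ≡ weightFrom (suc k) (drop 1 P)
  drop-weightFrom k [] = refl
  drop-weightFrom k (b ∷ P) = refl

  ≈ₚ-head-tail : ∀ P Q → pcoeff 0 P ≈ₗ pcoeff 0 Q → drop 1 P ≈ₚ drop 1 Q → P ≈ₚ Q
  ≈ₚ-head-tail P Q heads tails zero = heads
  ≈ₚ-head-tail P Q heads tails (suc j) =
    subst₂ _≈ₗ_ (≡.sym (pcoeff-suc j P)) (≡.sym (pcoeff-suc j Q)) (tails j)

  module _ (m : ℚ) where
    private
      Y^ : ℕ → LC
      Y^ = shPow (word (y m ∷ []))

    ∂-ψFrom-suc : ∀ k P → Poly0 P → ∂ (ψFrom m (suc k) P) ≈ₗ ψFrom m k (weightFrom k P)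
    ∂-ψFrom-suc k [] _ = ≈ₗ-refl
    ∂-ψFrom-suc k (b ∷ P) (b0 ∷ P0) =
      ≈ₗ-trans (∂-++ (b ⧢ Y^ (suc k)) _) (++-congₗ ∂[bYᵏ⁺¹] (∂-ψFrom-suc (suc k) P P0))
      where
        ∂[bYᵏ⁺¹] : ∂ (b ⧢ Y^ (suc k)) ≈ₗ (scale (suc k · 1#) b ⧢ Y^ k)
        ∂[bYᵏ⁺¹] = ≈ₗ-trans (∂-⧢-In0ₗ (In0⇒In0ₗ {b} b0) (Y^ (suc k)))
                   (≈ₗ-trans (⧢-congʳ b (∂-shPow m k))
                   (≈ₗ-trans (⧢-scaleʳ _ b (Y^ k)) (≈ₗ-sym (⧢-scaleˡ _ b (Y^ k)))))

    ∂-ψ : ∀ P → Poly0 P → ∂ (ψ m P) ≈ₗ ψ m (derivative P)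
    ∂-ψ [] _ = ≈ₗ-refl
    ∂-ψ (a ∷ P) (a0 ∷ P0) =
      ≈ₗ-trans (∂-++ (a ⧢ oneLC) _)
               (++-congₗ (≈ₗ-trans (∂-cong (⧢-identityʳ a)) (∂-In0ₗ (In0⇒In0ₗ {a} a0)))
                         (∂-ψFrom-suc 0 P P0))

    ψ-head-tail : ∀ P → ψ m P ≈ₗ (pcoeff 0 P ++ ψFrom m 1 (drop 1 P))
    ψ-head-tail [] = ≈ₗ-refl
    ψ-head-tail (a ∷ P) = ++-congₗ (⧢-identityʳ a) ≈ₗ-refl

  module _ {m : ℚ} (0<m : 0ℚ ℚ.< m) where
    private
      Y^ : ℕ → LC
      Y^ = shPow (word (y m ∷ []))

    In1ₗ-Y^ : ∀ n → In1ₗ (Y^ n)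
    In1ₗ-Y^ zero = In1ₗ-word [] (tt , tt)
    In1ₗ-Y^ (suc n) =
      In1ₗ-⧢ (In1ₗ-Y^ n) (In1ₗ-word (y m ∷ []) (tt , subst (0ℚ ℚ.<_) (≡.sym (ℚP.+-identityˡ m)) 0<m , tt))

    In1ₗ-ψFrom : ∀ i P → Poly0 P → In1ₗ (ψFrom m i P)
    In1ₗ-ψFrom i [] _ = [] , [] , ≈ₗ-refl
    In1ₗ-ψFrom i (a ∷ P) (a0 ∷ P0) =
      In1ₗ-++ (In1ₗ-⧢ (In0ₗ⇒In1ₗ (In0⇒In0ₗ {a} a0)) (In1ₗ-Y^ i)) (In1ₗ-ψFrom (suc i) P P0)

  Bounded : ℕ → LC → Set
  Bounded n = All (λ e → Word1 (proj₂ e) × length (proj₂ e) ℕ.≤ n)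

  AllWord1⇒Bounded : ∀ {L} → AllWord1 L → Σ ℕ λ n → Bounded n L
  AllWord1⇒Bounded [] = 0 , []
  AllWord1⇒Bounded {(r , w) ∷ L} (ww ∷ wL) with AllWord1⇒Bounded wL
  ... | n , bL = length w ℕ.+ n , (ww , ℕP.m≤m+n (length w) n) ∷
                 All.map (λ (ww′ , ≤n) → ww′ , ℕP.≤-trans ≤n (ℕP.m≤n+m n (length w))) bL

  ∂ʳ-Bounded : ∀ n w → Word1 w → length w ℕ.≤ suc n → Bounded n (∂ʳ (reverse w))
  ∂ʳ-Bounded n w ww |w|≤ with reverseView w
  ... | [] = []
  ... | u ∶ _ ∶ʳ c rewrite reverse-++ u (c ∷ []) = shorter c ww |w|≤
    where
      shorter : ∀ c → Word1 (u ++ c ∷ []) → length (u ++ c ∷ []) ℕ.≤ suc n →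
                Bounded n (∂ʳ (c ∷ reverse u))
      shorter x _ _ = []
      shorter (y l) wul |ul|≤ =
        (subst Word1 (≡.sym (reverse-involutive u)) (Word1-prefix u (y l ∷ []) wul) ,
         subst (ℕ._≤ n) (≡.sym (cong length (reverse-involutive u)))
           (ℕP.≤-pred (subst (ℕ._≤ suc n) (≡.trans (length-++ u) (ℕP.+-comm (length u) 1)) |ul|≤))) ∷ []

  ∂-Bounded : ∀ n {L} → Bounded (suc n) L → Bounded n (∂ L)
  ∂-Bounded n [] = []
  ∂-Bounded n {(r , w) ∷ L} ((ww , |w|≤) ∷ bL) =
    AllP.++⁺ (AllP.map⁺ (∂ʳ-Bounded n w ww |w|≤)) (∂-Bounded n bL)

  Bounded-zero⇒∂≈[] : ∀ {L} → Bounded 0 L → ∂ L ≈ₗ []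
  Bounded-zero⇒∂≈[] {L} b0 .lin-eq f = trans (lin-∂ f L) (go b0)
    where
      go : ∀ {L} → Bounded 0 L → lin (∂ᵗ f) L ≈ 0#
      go [] = ≈-refl
      go {(r , []) ∷ L} (_ ∷ b0) = trans (+-cong (zeroʳ r) (go b0)) (+-identityʳ 0#)

  module _ {ι : ℚ → Carrier} {μ : Carrier} (isQ : IsQmu R ι μ) where
    open IsQmu isQ
    open import Algebra.Definitions.RawMonoid ℚ.+-0-rawMonoid using () renaming (_×_ to _·ℚ_)

    ι-0ℚ : ι 0ℚ ≈ 0#
    ι-0ℚ = begin
      ι 0ℚ                          ≈⟨ //-rightDividesʳ (ι 0ℚ) (ι 0ℚ) ⟨
      ι 0ℚ + ι 0ℚ - ι 0ℚ            ≈⟨ +-congʳ (ι-+ 0ℚ 0ℚ) ⟨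
      ι (0ℚ ℚ.+ 0ℚ) - ι 0ℚ          ≈⟨ -‿inverseʳ (ι 0ℚ) ⟩
      0#                            ∎

    ι-·ℚ1 : ∀ k → ι (k ·ℚ 1ℚ) ≈ k · 1#
    ι-·ℚ1 zero = ι-0ℚ
    ι-·ℚ1 (suc k) = trans (ι-+ 1ℚ (k ·ℚ 1ℚ)) (+-cong ι-1 (ι-·ℚ1 k))

    0≤·ℚ1 : ∀ k → 0ℚ ℚ.≤ k ·ℚ 1ℚ
    0≤·ℚ1 zero = ℚP.≤-refl
    0≤·ℚ1 (suc k) = ℚP.+-mono-≤ (ℚP.nonNegative⁻¹ 1ℚ) (0≤·ℚ1 k)

    IsQmu⇒suc-invertible : ∀ k → Σ Carrier λ c → c * (suc k · 1#) ≈ 1#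
    IsQmu⇒suc-invertible k = ι (ℚ.1/ q) , (begin
      ι (ℚ.1/ q) * (suc k · 1#)     ≈⟨ *-congˡ (ι-·ℚ1 (suc k)) ⟨
      ι (ℚ.1/ q) * ι q              ≈⟨ ι-* (ℚ.1/ q) q ⟨
      ι (ℚ.1/ q ℚ.* q)              ≈⟨ ι-cong _ _ (ℚP.*-inverseˡ q) ⟩
      ι 1ℚ                          ≈⟨ ι-1 ⟩
      1#                            ∎)
      where
        q = suc k ·ℚ 1ℚ
        instance
          q≢0 : ℚ.NonZero q
          q≢0 = ℚ.>-nonZero (ℚP.+-mono-<-≤ (ℚP.positive⁻¹ 1ℚ) (0≤·ℚ1 k))

  -- ψ is bijective

  module _ (suc-invertible : ∀ k → Σ Carrier λ c → c * (suc k · 1#) ≈ 1#) where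
    scale-suc-cancel : ∀ k {p q} → scale (suc k · 1#) p ≈ₗ scale (suc k · 1#) q → p ≈ₗ q
    scale-suc-cancel k {p} {q} kp≈kq = ≈ₗ-trans (≈ₗ-sym (undo p)) (≈ₗ-trans (scale-congₗ c kp≈kq) (undo q))
      where
        c = proj₁ (suc-invertible k)
        undo : ∀ p → scale c (scale (suc k · 1#) p) ≈ₗ p
        undo p = ≈ₗ-trans (scale-scale c _ p) (scale-1# p (proj₂ (suc-invertible k)))

    weightFrom-cancel : ∀ k P Q → weightFrom k P ≈ₚ weightFrom k Q → P ≈ₚ Q
    weightFrom-cancel k P Q kP≈kQ zero = scale-suc-cancel k
      (subst₂ _≈ₗ_ (pcoeff-zero-weightFrom k P) (pcoeff-zero-weightFrom k Q) (kP≈kQ 0))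
    weightFrom-cancel k P Q kP≈kQ (suc j) =
      subst₂ _≈ₗ_ (≡.sym (pcoeff-suc j P)) (≡.sym (pcoeff-suc j Q))
        (weightFrom-cancel (suc k) (drop 1 P) (drop 1 Q) (λ i →
          subst₂ _≈ₗ_ (≡.trans (pcoeff-suc i (weightFrom k P)) (cong (pcoeff i) (drop-weightFrom k P)))
                      (≡.trans (pcoeff-suc i (weightFrom k Q)) (cong (pcoeff i) (drop-weightFrom k Q)))
                      (kP≈kQ (suc i))) j)

    integralFrom : ℕ → Poly → Poly
    integralFrom k [] = []
    integralFrom k (b ∷ Q) = scale (proj₁ (suc-invertible k)) b ∷ integralFrom (suc k) Q

    Poly0-integralFrom : ∀ k {Q} → Poly0 Q → Poly0 (integralFrom k Q)
    Poly0-integralFrom k [] = []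
    Poly0-integralFrom k {b ∷ Q} (b0 ∷ Q0) =
      In0-scale (proj₁ (suc-invertible k)) {b} b0 ∷ Poly0-integralFrom (suc k) Q0

    weightFrom-integralFrom : ∀ k Q → weightFrom k (integralFrom k Q) ≈ₚ Q
    weightFrom-integralFrom k [] j = ≈ₗ-refl
    weightFrom-integralFrom k (b ∷ Q) zero = ≈ₗ-trans (scale-scale _ _ b)
      (scale-1# b (trans (*-comm _ _) (proj₂ (suc-invertible k))))
    weightFrom-integralFrom k (b ∷ Q) (suc j) = weightFrom-integralFrom (suc k) Q j

    module _ (m : ℚ) where
      ψ-injective-≤ : ∀ n P Q → length P ℕ.≤ n → length Q ℕ.≤ n → Poly0 P → Poly0 Q →
                      ψ m P ≈ₗ ψ m Q → P ≈ₚ Q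
      ψ-injective-≤ zero [] [] _ _ _ _ _ j = ≈ₗ-refl
      ψ-injective-≤ (suc n) P Q |P|≤ |Q|≤ P0 Q0 ψP≈ψQ = ≈ₚ-head-tail P Q heads tails
        where
          length-derivative : ∀ P → length P ℕ.≤ suc n → length (derivative P) ℕ.≤ n
          length-derivative P |P|≤ = subst (ℕ._≤ n)
            (≡.sym (≡.trans (length-weightFrom 0 (drop 1 P)) (length-drop 1 P))) (ℕP.∸-monoˡ-≤ 1 |P|≤)
          Poly0-derivative : ∀ {P} → Poly0 P → Poly0 (derivative P)
          Poly0-derivative [] = []
          Poly0-derivative (_ ∷ P0) = Poly0-weightFrom 0 P0
          derivatives : derivative P ≈ₚ derivative Q
          derivatives = ψ-injective-≤ n _ _ (length-derivative P |P|≤) (length-derivative Q |Q|≤)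
            (Poly0-derivative P0) (Poly0-derivative Q0)
            (≈ₗ-trans (≈ₗ-sym (∂-ψ m P P0)) (≈ₗ-trans (∂-cong ψP≈ψQ) (∂-ψ m Q Q0)))
          tails : drop 1 P ≈ₚ drop 1 Q
          tails = weightFrom-cancel 0 (drop 1 P) (drop 1 Q) derivatives
          heads : pcoeff 0 P ≈ₗ pcoeff 0 Q
          heads = ++-cancelʳₗ (≈ₗ-trans (≈ₗ-sym (ψ-head-tail m P)) (≈ₗ-trans ψP≈ψQ (ψ-head-tail m Q)))
                              (ψFrom-cong m 1 (drop 1 P) (drop 1 Q) tails)

      ψ-injective : ∀ P Q → Poly0 P → Poly0 Q → ψ m P ≈ₗ ψ m Q → P ≈ₚ Q
      ψ-injective P Q = ψ-injective-≤ (length P ℕ.+ length Q) P Q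
        (ℕP.m≤m+n (length P) (length Q)) (ℕP.m≤n+m (length Q) (length P))

    module _ {m : ℚ} (0<m : 0ℚ ℚ.< m) where
      ψ-surjective-≤ : ∀ n {L} → Bounded n L → Σ Poly λ P → Poly0 P × (ψ m P ≈ₗ L)
      ψ-surjective-≤ zero {L} bL =
        L ∷ [] , In0ₗ⇒In0 (∂-kernel (All.map proj₁ bL) (Bounded-zero⇒∂≈[] bL)) ∷ [] , ψ-pconst m L
      ψ-surjective-≤ (suc n) {L} bL with ψ-surjective-≤ n (∂-Bounded n bL)
      ... | Q , Q0 , ψQ≈∂L = G ∷ I , In0ₗ⇒In0 G0 ∷ I0 , ψ[G∷I]≈L
        where
          I = integralFrom 0 Q
          I0 = Poly0-integralFrom 0 Q0
          T = ψFrom m 1 I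
          ∂T≈∂L : ∂ T ≈ₗ ∂ L
          ∂T≈∂L = ≈ₗ-trans (∂-ψFrom-suc m 0 I I0)
                    (≈ₗ-trans (ψFrom-cong m 0 (weightFrom 0 I) Q (weightFrom-integralFrom 0 Q)) ψQ≈∂L)
          T₁ = In1ₗ-ψFrom 0<m 1 I I0
          LT = proj₁ T₁
          T≈LT : T ≈ₗ LT
          T≈LT = proj₂ (proj₂ T₁)
          G = L ⊖ LT
          G0 : In0ₗ G
          G0 = ∂-kernel (AllP.++⁺ (All.map proj₁ bL) (AllWord1-scale _ (proj₁ (proj₂ T₁))))
                        (≈ₗ-trans (∂-⊖ L LT) (⊖-self (≈ₗ-trans (≈ₗ-sym ∂T≈∂L) (∂-cong T≈LT))))
          ψ[G∷I]≈L : ψ m (G ∷ I) ≈ₗ L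
          ψ[G∷I]≈L = ≈ₗ-trans (++-congₗ (⧢-identityʳ G) T≈LT) (⊖-++-cancel L LT)

      ψ-surjective : ∀ {L} → AllWord1 L → Σ Poly λ P → Poly0 P × (ψ m P ≈ₗ L)
      ψ-surjective wL = ψ-surjective-≤ _ (proj₂ (AllWord1⇒Bounded wL))

theorem4p11 : (R : CommutativeRing 0ℓ 0ℓ) (ι : ℚ → CommutativeRing.Carrier R)
    (μ : CommutativeRing.Carrier R) → IsQmu R ι μ →
    (m : ℚ) → 0ℚ ℚ.< m →
    let open Shuffle R in
    (∀ P Q → Poly0 P → Poly0 Q → P ≋P Q → ψ m P ≋ ψ m Q) ×
    (∀ P → Poly0 P → In1 (ψ m P)) ×
    (∀ P Q → Poly0 P → Poly0 Q → ψ m (padd P Q) ≋ (ψ m P ⊕ ψ m Q)) ×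
    (∀ P Q → Poly0 P → Poly0 Q → ψ m (pmul P Q) ≋ (ψ m P ⧢ ψ m Q)) ×
    (∀ a → In0 a → ψ m (pconst a) ≋ a) ×
    (∀ P Q → Poly0 P → Poly0 Q → ψ m P ≋ ψ m Q → P ≋P Q) ×
    (∀ p → In1 p → Σ Poly λ P → Poly0 P × (ψ m P ≋ p))
theorem4p11 R ι μ isQ m 0<m =
    (λ P Q _ _ P≋Q → ≈ₗ⇒≋ (ψFrom-cong m 0 P Q (≋P⇒≈ₚ P Q P≋Q)))
  , (λ P P0 → In1ₗ⇒In1 (In1ₗ-ψFrom 0<m 0 P P0))
  , (λ P Q _ _ → ≈ₗ⇒≋ (ψFrom-padd m 0 P Q))
  , (λ P Q _ _ → ≈ₗ⇒≋ (ψFrom-pmul m 0 P Q))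
  , (λ a _ → ≈ₗ⇒≋ (ψ-pconst m a))
  , (λ P Q P0 Q0 ψP≋ψQ → ≈ₚ⇒≋P P Q (ψ-injective (IsQmu⇒suc-invertible isQ) m P Q P0 Q0 (≋⇒≈ₗ {ψ m P} ψP≋ψQ)))
  , λ p (L , wL , p≋L) → let (P , P0 , ψP≈L) = ψ-surjective (IsQmu⇒suc-invertible isQ) 0<m wL in
      P , P0 , ≈ₗ⇒≋ (≈ₗ-trans ψP≈L (≈ₗ-sym (≋⇒≈ₗ {p} p≋L)))
  where
    open Shuffle R
    open ShuffleAlgebra R
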